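{- There exists a Steiner system $S(2,9,3321)$; that is, there exist a set $X$ with $|X| = 3321$ and a collection $\mathcal{B}$ of $9$-element subsets of $X$ such that every $2$-element subset of $X$ is contained in exactly one member of $\mathcal{B}$.
   Context: A Steiner system $S(2,k,v)$ is a pair $(X,\mathcal{B})$ where $X$ is a set of $v$ points and $\mathcal{B}$ is a family of $k$-element subsets of $X$ such that every pair of distinct points of $X$ lies in exactly one member of $\mathcal{B}$. Note $3321 = 369\cdot 9$. -}

module Defs where

open import Data.Nat using (ℕ)
open import Data.Fin using (Fin)
open import Data.Fin.Subset using (Subset; _∈_; ∣_∣)
open import Data.Product using (Σ; _×_; ∃)
open import Relation.Binary.PropositionalEquality using (_≡_)
open import Relation.Nullary using (¬_)

-- SteinerSystem₂ k v = a Steiner system S(2,k,v) on the point set Fin v: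
-- a family of b blocks (indexed by Fin b), each a k-element subset of Fin v,
-- such that every pair of distinct points lies in exactly one block.
-- "Exactly one" = existence plus uniqueness of the block index; since k ≥ 2
-- blocks, repeated blocks would violate uniqueness, so this is the same as
-- exactly one member of the collection.
record SteinerSystem₂ (k v : ℕ) : Set where
  field
    b      : ℕ
    block  : Fin b → Subset v
    size   : ∀ i → ∣ block i ∣ ≡ k
    cover  : ∀ (x y : Fin v) → ¬ x ≡ y → ∃ λ i → x ∈ block i × y ∈ block i
    unique : ∀ (x y : Fin v) → ¬ x ≡ y → ∀ i j →
               x ∈ block i → y ∈ block i → x ∈ block j → y ∈ block j → i ≡ j

{-# OPTIONS --safe #-}
-- Let F₉ = F₃[i] with i² = −1, K = F₉² and G = K × ℤ₄₁, a group of order 3321.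
-- The 45 base blocks below form a (G, K × {0}, 9, 1) relative difference family:
-- no difference b − b′ of two points of a base block lies in K × {0}, and every
-- other element of G is such a difference in exactly one way.  Hence the 45 · 3321
-- translates of the base blocks contain every pair of points from different cosets
-- of K × {0} exactly once, and no pair from the same coset.  The pairs inside a
-- coset are covered by a copy of the affine plane AG(2,9) = S(2,9,81) on it.  Both
-- facts about the concrete data are verified by exhaustive evaluation; for the
-- difference family a precomputed inverse of the difference map makes this a
-- single pass over G.
module Submission where

open import Defs
open import Algebra.Bundles using (AbelianGroup)
open import Algebra.Consequences.Propositional using (comm∧idˡ⇒idʳ; comm∧invˡ⇒invʳ)
open import Algebra.Core using (Op₁; Op₂)
import Algebra.Properties.AbelianGroup as AbelianGroupProperties
import Algebra.Properties.CommutativeSemigroup as CommutativeSemigroupProperties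
open import Algebra.Structures using (IsAbelianGroup)
open import Data.Empty using (⊥; ⊥-elim)
open import Data.Fin as Fin using (Fin; zero; suc; toℕ)
open import Data.Fin.Properties
  using (toℕ-injective; toℕ-fromℕ<; toℕ<n; suc-injective; 0≢1+n; all?; any?; *↔×; +↔⊎)
open import Data.Fin.Subset using (Subset; _∈_; _∉_; ∣_∣; inside; outside) renaming (⊥ to ∅)
open import Data.Fin.Subset.Properties using (∣⊥∣≡0; ∉⊥)
open import Data.Nat as ℕ using (ℕ; zero; suc; NonZero; _∸_; _%_; _/_; >-nonZero⁻¹)
open import Data.Nat.DivMod using (_mod_; m%n<n; %-distribˡ-+; m%n%n≡m%n; m<n⇒m%n≡m; n%n≡0)
open import Data.Nat.Properties using (+-comm; +-assoc; m∸n+n≡m; <⇒≤)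
open import Data.Product as Product using (∃; ∃₂; _×_; _,_; proj₁; proj₂; zip′)
open import Data.Product.Function.NonDependent.Propositional using (_×-↔_)
open import Data.Product.Properties using () renaming (≡-dec to ×-≡-dec)
open import Data.Sum using (_⊎_; inj₁; inj₂; [_,_])
open import Data.Sum.Function.Propositional using (_⊎-↔_)
open import Data.Sum.Properties using () renaming (≡-dec to ⊎-≡-dec)
open import Data.Vec using (Vec; []; _∷_; lookup; _[_]≔_; here; there)
open import Data.Vec.Properties using ([]≔-updates; []≔-minimal; lookup∘update′; []=⇒lookup; lookup⇒[]=)
open import Function using (_∘_; id; _↔_; Inverse; Injection; Injective)
open import Function.Properties.Inverse using (↔-refl; ↔-sym; ↔-trans; ↔⇒↣)
open import Level using (0ℓ)
open import Relation.Binary.Definitions using (DecidableEquality)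
open import Relation.Binary.PropositionalEquality
  using (_≡_; _≢_; refl; sym; trans; cong; cong₂; subst; isEquivalence; module ≡-Reasoning)
open import Relation.Nullary using (Dec; yes; no; ¬?; _×-dec_; _→-dec_; map′; contradiction)
open import Relation.Nullary.Decidable using (True; toWitness)
open import Relation.Unary using (Decidable)

∣p[x]≔inside∣≡1+∣p∣ : ∀ {n} (p : Subset n) {x} → x ∉ p → ∣ p [ x ]≔ inside ∣ ≡ suc ∣ p ∣
∣p[x]≔inside∣≡1+∣p∣ (outside ∷ p) {zero}  _   = refl
∣p[x]≔inside∣≡1+∣p∣ (inside  ∷ p) {zero}  x∉p = contradiction here x∉p
∣p[x]≔inside∣≡1+∣p∣ (outside ∷ p) {suc x} x∉p = ∣p[x]≔inside∣≡1+∣p∣ p (x∉p ∘ there)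
∣p[x]≔inside∣≡1+∣p∣ (inside  ∷ p) {suc x} x∉p = cong suc (∣p[x]≔inside∣≡1+∣p∣ p (x∉p ∘ there))

image : ∀ {m n} → (Fin m → Fin n) → Subset n
image {zero}  f = ∅
image {suc m} f = image (f ∘ suc) [ f zero ]≔ inside

∈-image⁺ : ∀ {m n} (f : Fin m → Fin n) i → f i ∈ image f
∈-image⁺ f zero    = []≔-updates (image (f ∘ suc)) (f zero)
∈-image⁺ f (suc i) with f (suc i) Fin.≟ f zero
... | yes fi≡f0 = subst (_∈ image f) (sym fi≡f0) ([]≔-updates (image (f ∘ suc)) (f zero))
... | no  fi≢f0 = []≔-minimal (image (f ∘ suc)) (f (suc i)) (f zero) fi≢f0 (∈-image⁺ (f ∘ suc) i)

∈-image⁻ : ∀ {m n} (f : Fin m → Fin n) {x} → x ∈ image f → ∃ λ i → f i ≡ x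
∈-image⁻ {zero}  f x∈ = contradiction x∈ ∉⊥
∈-image⁻ {suc m} f {x} x∈ with f zero Fin.≟ x
... | yes f0≡x = zero , f0≡x
... | no  f0≢x = Product.map suc id (∈-image⁻ (f ∘ suc) x∈rest)
  where
  x∈rest : x ∈ image (f ∘ suc)
  x∈rest = lookup⇒[]= x _
    (trans (sym (lookup∘update′ (f0≢x ∘ sym) (image (f ∘ suc)) inside)) ([]=⇒lookup x∈))

injective⇒∣image∣≡m : ∀ {m n} (f : Fin m → Fin n) → Injective _≡_ _≡_ f → ∣ image f ∣ ≡ m
injective⇒∣image∣≡m {zero}  {n} f _   = ∣⊥∣≡0 n
injective⇒∣image∣≡m {suc m}     f inj =
  trans (∣p[x]≔inside∣≡1+∣p∣ (image (f ∘ suc)) f0∉)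
        (cong suc (injective⇒∣image∣≡m (f ∘ suc) (suc-injective ∘ inj)))
  where
  f0∉ : f zero ∉ image (f ∘ suc)
  f0∉ f0∈ = 0≢1+n (inj (sym (proj₂ (∈-image⁻ (f ∘ suc) f0∈))))

-- Steiner systems on an arbitrary point set

↔-to-injective : ∀ {A B : Set} (A↔B : A ↔ B) → Injective _≡_ _≡_ (Inverse.to A↔B)
↔-to-injective A↔B = Injection.injective (↔⇒↣ A↔B)

infix 4 _∈[_]_
_∈[_]_ : ∀ {k} {P Block : Set} → P → (Block → Fin k → P) → Block → Set
x ∈[ point ] B = ∃ λ i → point B i ≡ x

record Steiner₂ (k : ℕ) (P : Set) : Set₁ where
  field
    Block           : Set
    point           : Block → Fin k → P
    point-injective : ∀ B → Injective _≡_ _≡_ (point B)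
    cover           : ∀ {x y} → x ≢ y → ∃ λ B → x ∈[ point ] B × y ∈[ point ] B
    unique          : ∀ {x y} → x ≢ y → ∀ {B C} →
                      x ∈[ point ] B → y ∈[ point ] B → x ∈[ point ] C → y ∈[ point ] C → B ≡ C

relabel : ∀ {k P P′} → Steiner₂ k P → P ↔ P′ → Steiner₂ k P′
relabel S P↔P′ = record
  { Block           = Block
  ; point           = λ B → to ∘ point B
  ; point-injective = λ B → point-injective B ∘ ↔-to-injective P↔P′
  ; cover           = λ x≢y → Product.map id (Product.map ∈⁺ ∈⁺) (cover (x≢y ∘ from-injective))
  ; unique          = λ x≢y x∈B y∈B x∈C y∈C →
      unique (x≢y ∘ from-injective) (∈⁻ x∈B) (∈⁻ y∈B) (∈⁻ x∈C) (∈⁻ y∈C)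
  }
  where
  open Steiner₂ S
  open Inverse P↔P′
  from-injective : Injective _≡_ _≡_ from
  from-injective = ↔-to-injective (↔-sym P↔P′)
  ∈⁺ : ∀ {x B} → from x ∈[ point ] B → ∃ λ i → to (point B i) ≡ x
  ∈⁺ {x} (i , eq) = i , trans (cong to eq) (strictlyInverseˡ x)
  ∈⁻ : ∀ {x B} → (∃ λ i → to (point B i) ≡ x) → from x ∈[ point ] B
  ∈⁻ {x} {B} (i , eq) = i , trans (sym (strictlyInverseʳ (point B i))) (cong from eq)

toSteinerSystem₂ : ∀ {k v b} (S : Steiner₂ k (Fin v)) → Steiner₂.Block S ↔ Fin b → SteinerSystem₂ k v
toSteinerSystem₂ {b = b} S B↔Fin = record
  { b      = b
  ; block  = block
  ; size   = λ i → injective⇒∣image∣≡m (point (from i)) (point-injective (from i))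
  ; cover  = λ _ _ x≢y → let B , x∈B , y∈B = cover x≢y in to B , ∈⁺ x∈B , ∈⁺ y∈B
  ; unique = λ _ _ x≢y i j x∈i y∈i x∈j y∈j → ↔-to-injective (↔-sym B↔Fin)
      (unique x≢y (∈-image⁻ _ x∈i) (∈-image⁻ _ y∈i) (∈-image⁻ _ x∈j) (∈-image⁻ _ y∈j))
  }
  where
  open Steiner₂ S
  open Inverse B↔Fin
  block : Fin b → Subset _
  block i = image (point (from i))
  ∈⁺ : ∀ {x B} → x ∈[ point ] B → x ∈ block (to B)
  ∈⁺ {B = B} (i , refl) =
    subst (λ C → point B i ∈ image (point C)) (sym (strictlyInverseʳ B)) (∈-image⁺ (point B) i)

module _ {A : Set} {_∙_ : Op₂ A} {ε : A} {_⁻¹ : Op₁ A} where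
  open import Algebra.Definitions {A = A} _≡_

  isAbelianGroupˡ : Associative _∙_ → Commutative _∙_ → LeftIdentity ε _∙_ → LeftInverse ε _⁻¹ _∙_ →
                    IsAbelianGroup _≡_ _∙_ ε _⁻¹
  isAbelianGroupˡ assoc comm identityˡ inverseˡ = record
    { isGroup = record
      { isMonoid = record
        { isSemigroup = record
          { isMagma = record { isEquivalence = isEquivalence ; ∙-cong = cong₂ _∙_ }
          ; assoc   = assoc
          }
        ; identity = identityˡ , comm∧idˡ⇒idʳ comm identityˡ
        }
      ; inverse = inverseˡ , comm∧invˡ⇒invʳ comm inverseˡ
      ; ⁻¹-cong = cong _⁻¹
      }
    ; comm = comm
    }

×-isAbelianGroup : ∀ {A B : Set}
  {_∙₁_ : Op₂ A} {ε₁ : A} {_⁻¹₁ : Op₁ A} {_∙₂_ : Op₂ B} {ε₂ : B} {_⁻¹₂ : Op₁ B} →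
  IsAbelianGroup _≡_ _∙₁_ ε₁ _⁻¹₁ → IsAbelianGroup _≡_ _∙₂_ ε₂ _⁻¹₂ →
  IsAbelianGroup _≡_ (zip′ _∙₁_ _∙₂_) (ε₁ , ε₂) (Product.map _⁻¹₁ _⁻¹₂)
×-isAbelianGroup G H = isAbelianGroupˡ
  (λ _ _ _ → cong₂ _,_ (G.assoc _ _ _) (H.assoc _ _ _))
  (λ _ _ → cong₂ _,_ (G.comm _ _) (H.comm _ _))
  (λ _ → cong₂ _,_ (G.identityˡ _) (H.identityˡ _))
  (λ _ → cong₂ _,_ (G.inverseˡ _) (H.inverseˡ _))
  where
  module G = IsAbelianGroup G
  module H = IsAbelianGroup H

module Modular (n : ℕ) .⦃ _ : NonZero n ⦄ where

  infix  8 -_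
  infixl 7 _*_
  infixl 6 _+_

  0# : Fin n
  0# = 0 mod n

  _+_ : Fin n → Fin n → Fin n
  a + b = (toℕ a ℕ.+ toℕ b) mod n

  -_ : Fin n → Fin n
  - a = (n ∸ toℕ a) mod n

  _*_ : Fin n → Fin n → Fin n
  a * b = (toℕ a ℕ.* toℕ b) mod n

  private
    toℕ-mod : ∀ m → toℕ (m mod n) ≡ m % n
    toℕ-mod m = toℕ-fromℕ< (m%n<n m n)

    %-absorbˡ : ∀ x y → (x % n ℕ.+ y) % n ≡ (x ℕ.+ y) % n
    %-absorbˡ x y = begin
      (x % n ℕ.+ y) % n           ≡⟨ %-distribˡ-+ (x % n) y n ⟩
      (x % n % n ℕ.+ y % n) % n   ≡⟨ cong (λ z → (z ℕ.+ y % n) % n) (m%n%n≡m%n x n) ⟩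
      (x % n ℕ.+ y % n) % n       ≡⟨ %-distribˡ-+ x y n ⟨
      (x ℕ.+ y) % n               ∎
      where open ≡-Reasoning

    toℕ-mod-+ : ∀ m b → toℕ (m mod n + b) ≡ (m ℕ.+ toℕ b) % n
    toℕ-mod-+ m b =
      trans (toℕ-mod _) (trans (cong (λ z → (z ℕ.+ toℕ b) % n) (toℕ-mod m)) (%-absorbˡ m (toℕ b)))

  isAbelianGroup : IsAbelianGroup _≡_ _+_ 0# -_
  isAbelianGroup = isAbelianGroupˡ +-assoc′ +-comm′ +-identityˡ′ -‿inverseˡ′
    where
    open ≡-Reasoning

    +-comm′ : ∀ a b → a + b ≡ b + a
    +-comm′ a b = cong (_mod n) (+-comm (toℕ a) (toℕ b))

    +-assoc′ : ∀ a b c → (a + b) + c ≡ a + (b + c)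
    +-assoc′ a b c = toℕ-injective (begin
      toℕ ((a + b) + c)                   ≡⟨ toℕ-mod-+ (toℕ a ℕ.+ toℕ b) c ⟩
      (toℕ a ℕ.+ toℕ b ℕ.+ toℕ c) % n     ≡⟨ cong (_% n) (+-assoc (toℕ a) _ _) ⟩
      (toℕ a ℕ.+ (toℕ b ℕ.+ toℕ c)) % n   ≡⟨ cong (_% n) (+-comm (toℕ a) _) ⟩
      (toℕ b ℕ.+ toℕ c ℕ.+ toℕ a) % n     ≡⟨ toℕ-mod-+ (toℕ b ℕ.+ toℕ c) a ⟨
      toℕ ((b + c) + a)                   ≡⟨ cong toℕ (+-comm′ (b + c) a) ⟩
      toℕ (a + (b + c))                   ∎)

    +-identityˡ′ : ∀ a → 0# + a ≡ a
    +-identityˡ′ a = toℕ-injective (trans (toℕ-mod-+ 0 a) (m<n⇒m%n≡m (toℕ<n a)))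

    -‿inverseˡ′ : ∀ a → (- a) + a ≡ 0#
    -‿inverseˡ′ a = toℕ-injective (begin
      toℕ ((- a) + a)             ≡⟨ toℕ-mod-+ (n ∸ toℕ a) a ⟩
      (n ∸ toℕ a ℕ.+ toℕ a) % n   ≡⟨ cong (_% n) (m∸n+n≡m (<⇒≤ (toℕ<n a))) ⟩
      n % n                       ≡⟨ n%n≡0 n ⟩
      0                           ≡⟨ m<n⇒m%n≡m (>-nonZero⁻¹ n) ⟨
      0 % n                       ≡⟨ toℕ-mod 0 ⟨
      toℕ 0#                      ∎)

-- Relative difference families

module RelativeDifferenceFamily
  {K Q : Set}
  {_+ᴷ_ : Op₂ K} {0ᴷ : K} { -ᴷ_ : Op₁ K } (K-isAbelianGroup : IsAbelianGroup _≡_ _+ᴷ_ 0ᴷ -ᴷ_)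
  {_+ᵠ_ : Op₂ Q} {0ᵠ : Q} { -ᵠ_ : Op₁ Q } (Q-isAbelianGroup : IsAbelianGroup _≡_ _+ᵠ_ 0ᵠ -ᵠ_)
  (_≟ᵠ_ : DecidableEquality Q)
  where

  G : Set
  G = K × Q

  Q-abelianGroup : AbelianGroup 0ℓ 0ℓ
  Q-abelianGroup = record { isAbelianGroup = Q-isAbelianGroup }

  G-abelianGroup : AbelianGroup 0ℓ 0ℓ
  G-abelianGroup = record { isAbelianGroup = ×-isAbelianGroup K-isAbelianGroup Q-isAbelianGroup }

  open AbelianGroup G-abelianGroup
    using (_∙_; _-_; ε; _⁻¹; assoc; inverseʳ; identityʳ; commutativeSemigroup)
  open AbelianGroupProperties G-abelianGroup
    using (∙-cancelˡ; \\-leftDividesˡ; //-rightDividesˡ; ⁻¹-∙-comm)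
  open CommutativeSemigroupProperties commutativeSemigroup using (interchange)
  open AbelianGroupProperties Q-abelianGroup
    using () renaming (x∙y⁻¹≈ε⇒x≈y to difference≡0⇒≡; x≈y⇒x∙y⁻¹≈ε to ≡⇒difference≡0)

  translate-difference : ∀ a c g → (a ∙ g) - (c ∙ g) ≡ a - c
  translate-difference a c g = begin
    (a ∙ g) ∙ (c ∙ g) ⁻¹      ≡⟨ cong ((a ∙ g) ∙_) (⁻¹-∙-comm c g) ⟨
    (a ∙ g) ∙ (c ⁻¹ ∙ g ⁻¹)   ≡⟨ interchange a g (c ⁻¹) (g ⁻¹) ⟩
    (a - c) ∙ (g - g)         ≡⟨ cong ((a - c) ∙_) (inverseʳ g) ⟩
    (a - c) ∙ ε               ≡⟨ identityʳ (a - c) ⟩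
    a - c                     ∎
    where open ≡-Reasoning

  translate-onto : ∀ {a c x y} → a - c ≡ x - y → a ∙ (c ⁻¹ ∙ y) ≡ x × c ∙ (c ⁻¹ ∙ y) ≡ y
  translate-onto {a} {c} {x} {y} a-c≡x-y = a↦x , \\-leftDividesˡ c y
    where
    open ≡-Reasoning
    a↦x : a ∙ (c ⁻¹ ∙ y) ≡ x
    a↦x = begin
      a ∙ (c ⁻¹ ∙ y)   ≡⟨ assoc a (c ⁻¹) y ⟨
      (a - c) ∙ y      ≡⟨ cong (_∙ y) a-c≡x-y ⟩
      (x - y) ∙ y      ≡⟨ //-rightDividesˡ y x ⟩
      x                ∎

  module _ {s k : ℕ} (base : Fin s → Fin k → G) where

    difference : Fin s → Fin k → Fin k → G
    difference r i j = base r i - base r j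

    record IsRelativeDifferenceFamily : Set where
      field
        difference∉K      : ∀ r {i j} → i ≢ j → proj₂ (difference r i j) ≢ 0ᵠ
        difference-covers : ∀ d → proj₂ d ≢ 0ᵠ → ∃ λ r → ∃₂ λ i j → difference r i j ≡ d
        difference-unique : ∀ {r i j r′ i′ j′} → i ≢ j → i′ ≢ j′ →
                            difference r i j ≡ difference r′ i′ j′ → r ≡ r′ × i ≡ i′

  module _ {s k} {base : Fin s → Fin k → G} (rdf : IsRelativeDifferenceFamily base) where
    open IsRelativeDifferenceFamily rdf

    translate-transversal : ∀ r g {i j} → i ≢ j → proj₂ (base r i ∙ g) ≢ proj₂ (base r j ∙ g)
    translate-transversal r g {i} {j} i≢j same-coset = difference∉K r i≢j (begin
      proj₂ (difference base r i j)              ≡⟨ cong proj₂ (translate-difference (base r i) (base r j) g) ⟨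
      proj₂ ((base r i ∙ g) - (base r j ∙ g))    ≡⟨ ≡⇒difference≡0 same-coset ⟩
      0ᵠ                                         ∎)
      where open ≡-Reasoning

    develop : Steiner₂ k K → Steiner₂ k G
    develop S = record
      { Block           = (Fin s × G) ⊎ (S.Block × Q)
      ; point           = point
      ; point-injective = point-injective
      ; cover           = cover
      ; unique          = unique
      }
      where
      module S = Steiner₂ S

      point : (Fin s × G) ⊎ (S.Block × Q) → Fin k → G
      point (inj₁ (r , g)) i = base r i ∙ g
      point (inj₂ (L , q)) i = S.point L i , q

      point-injective : ∀ B → Injective _≡_ _≡_ (point B)
      point-injective (inj₁ (r , g)) {i} {j} eq with i Fin.≟ j
      ... | yes i≡j = i≡j
      ... | no  i≢j = contradiction (cong proj₂ eq) (translate-transversal r g i≢j)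
      point-injective (inj₂ (L , q)) eq = S.point-injective L (cong proj₁ eq)

      cover : ∀ {x y} → x ≢ y → ∃ λ B → x ∈[ point ] B × y ∈[ point ] B
      cover {x} {y} x≢y with proj₂ x ≟ᵠ proj₂ y
      ... | no x₂≢y₂ =
        let r , i , j , δ≡ = difference-covers (x - y) (x₂≢y₂ ∘ difference≡0⇒≡ (proj₂ x) (proj₂ y))
            i↦x , j↦y = translate-onto δ≡
        in inj₁ (r , base r j ⁻¹ ∙ y) , (i , i↦x) , (j , j↦y)
      ... | yes x₂≡y₂ =
        let L , (i , i↦x₁) , (j , j↦y₁) = S.cover (λ x₁≡y₁ → x≢y (cong₂ _,_ x₁≡y₁ x₂≡y₂))
        in inj₂ (L , proj₂ x) , (i , cong (_, proj₂ x) i↦x₁) , (j , cong₂ _,_ j↦y₁ x₂≡y₂)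

      no-pair-in-translate-and-coset : ∀ {x y r g L q} → x ≢ y →
        x ∈[ point ] inj₁ (r , g) → y ∈[ point ] inj₁ (r , g) →
        x ∈[ point ] inj₂ (L , q) → y ∈[ point ] inj₂ (L , q) → ⊥
      no-pair-in-translate-and-coset {r = r} {g} x≢y (i , refl) (j , refl) (_ , i′↦x) (_ , j′↦y) =
        translate-transversal r g (λ { refl → x≢y refl })
          (trans (cong proj₂ (sym i′↦x)) (cong proj₂ j′↦y))

      unique : ∀ {x y} → x ≢ y → ∀ {B C} →
               x ∈[ point ] B → y ∈[ point ] B → x ∈[ point ] C → y ∈[ point ] C → B ≡ C
      unique x≢y {inj₁ (r , g)} {inj₁ (r′ , g′)} (i , refl) (j , refl) (i′ , i′↦x) (j′ , j′↦y)
        with difference-unique (λ { refl → x≢y refl }) (λ { refl → x≢y (trans (sym i′↦x) j′↦y) }) δ≡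
        where
        δ≡ : difference base r i j ≡ difference base r′ i′ j′
        δ≡ = begin
          difference base r i j                   ≡⟨ translate-difference (base r i) (base r j) g ⟨
          (base r i ∙ g) - (base r j ∙ g)         ≡⟨ cong₂ _-_ i′↦x j′↦y ⟨
          (base r′ i′ ∙ g′) - (base r′ j′ ∙ g′)   ≡⟨ translate-difference (base r′ i′) (base r′ j′) g′ ⟩
          difference base r′ i′ j′                ∎
          where open ≡-Reasoning
      ... | refl , refl = cong (λ h → inj₁ (r , h)) (∙-cancelˡ (base r i) g g′ (sym i′↦x))
      unique x≢y {inj₁ _} {inj₂ _} x∈B y∈B x∈C y∈C =
        ⊥-elim (no-pair-in-translate-and-coset x≢y x∈B y∈B x∈C y∈C)
      unique x≢y {inj₂ _} {inj₁ _} x∈B y∈B x∈C y∈C =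
        ⊥-elim (no-pair-in-translate-and-coset x≢y x∈C y∈C x∈B y∈B)
      unique x≢y {inj₂ (L , q)} {inj₂ (L′ , q′)} (i , refl) (j , refl) (i′ , i′↦x) (j′ , j′↦y) =
        cong₂ (λ L q → inj₂ (L , q))
          (S.unique (x≢y ∘ cong (_, q)) (i , refl) (j , refl)
                    (i′ , cong proj₁ i′↦x) (j′ , cong proj₁ j′↦y))
          (sym (cong proj₂ i′↦x))

Exhaustible : Set → Set₁
Exhaustible A = ∀ {P : A → Set} → Decidable P → Dec (∀ x → P x)

×-exhaustible : ∀ {A B} → Exhaustible A → Exhaustible B → Exhaustible (A × B)
×-exhaustible ∀A? ∀B? P? =
  map′ (λ h (a , b) → h a b) (λ h a b → h (a , b)) (∀A? λ a → ∀B? λ b → P? (a , b))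

⊎-exhaustible : ∀ {A B} → Exhaustible A → Exhaustible B → Exhaustible (A ⊎ B)
⊎-exhaustible ∀A? ∀B? P? =
  map′ (λ (hA , hB) → [ hA , hB ]) (λ h → h ∘ inj₁ , h ∘ inj₂) (∀A? (P? ∘ inj₁) ×-dec ∀B? (P? ∘ inj₂))

by-exhaustion : ∀ {A} {P : A → Set} (∀? : Exhaustible A) (P? : Decidable P) → {True (∀? P?)} → ∀ x → P x
by-exhaustion ∀? P? {holds} = toWitness holds

-- The affine plane AG(2,9)

module ℤ₃ = Modular 3

-- a + b i with i² = −1
F₉ : Set
F₉ = Fin 3 × Fin 3

module F₉ where
  infix  8 _⁻¹
  infixl 7 _·_
  infixl 6 _+_ _-_

  _+_ : F₉ → F₉ → F₉
  _+_ = zip′ ℤ₃._+_ ℤ₃._+_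

  _-_ : F₉ → F₉ → F₉
  (a , b) - (c , d) = a ℤ₃.+ ℤ₃.- c , b ℤ₃.+ ℤ₃.- d

  _·_ : F₉ → F₉ → F₉
  (a , b) · (c , d) = a ℤ₃.* c ℤ₃.+ ℤ₃.- (b ℤ₃.* d) , a ℤ₃.* d ℤ₃.+ b ℤ₃.* c

  -- (a + b i)⁻¹ = (a − b i) / (a² + b²), and every nonzero element of F₃ is its own inverse.
  _⁻¹ : F₉ → F₉
  (a , b) ⁻¹ = n ℤ₃.* a , n ℤ₃.* ℤ₃.- b
    where n = a ℤ₃.* a ℤ₃.+ b ℤ₃.* b

  _≟_ : DecidableEquality F₉
  _≟_ = ×-≡-dec Fin._≟_ Fin._≟_

  isAbelianGroup : IsAbelianGroup _≡_ _+_ (ℤ₃.0# , ℤ₃.0#) (Product.map ℤ₃.-_ ℤ₃.-_)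
  isAbelianGroup = ×-isAbelianGroup ℤ₃.isAbelianGroup ℤ₃.isAbelianGroup

F₉-exhaustible : Exhaustible F₉
F₉-exhaustible = ×-exhaustible all? all?

Fin9↔F₉ : Fin 9 ↔ F₉
Fin9↔F₉ = *↔×

K : Set
K = F₉ × F₉

_≟ᴷ_ : DecidableEquality K
_≟ᴷ_ = ×-≡-dec F₉._≟_ F₉._≟_

K-exhaustible : Exhaustible K
K-exhaustible = ×-exhaustible F₉-exhaustible F₉-exhaustible

K-isAbelianGroup : IsAbelianGroup _≡_ (zip′ F₉._+_ F₉._+_) ((ℤ₃.0# , ℤ₃.0#) , (ℤ₃.0# , ℤ₃.0#))
                                      (Product.map (Product.map ℤ₃.-_ ℤ₃.-_) (Product.map ℤ₃.-_ ℤ₃.-_))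
K-isAbelianGroup = ×-isAbelianGroup F₉.isAbelianGroup F₉.isAbelianGroup

Fin81↔K : Fin 81 ↔ K
Fin81↔K = ↔-trans *↔× (Fin9↔F₉ ×-↔ Fin9↔F₉)

-- inj₁ c is the line x = c, and inj₂ (m , c) the line y = m x + c.
Line : Set
Line = F₉ ⊎ F₉ × F₉

onLine : Line → F₉ → K
onLine (inj₁ c)       t = c , t
onLine (inj₂ (m , c)) t = t , m F₉.· t F₉.+ c

onLine-injective : ∀ L → Injective _≡_ _≡_ (onLine L)
onLine-injective (inj₁ _) = cong proj₂
onLine-injective (inj₂ _) = cong proj₁

lineThrough : K → K → Line
lineThrough (x₁ , y₁) (x₂ , y₂) with x₁ F₉.≟ x₂
... | yes _ = inj₁ x₁
... | no  _ = inj₂ (m , y₁ F₉.- m F₉.· x₁)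
  where m = (y₂ F₉.- y₁) F₉.· (x₂ F₉.- x₁) F₉.⁻¹

linePoint : Line → Fin 9 → K
linePoint L = onLine L ∘ Inverse.to Fin9↔F₉

lineThrough-∋ : ∀ p → let x , y = p in
                x ≢ y → x ∈[ linePoint ] lineThrough x y × y ∈[ linePoint ] lineThrough x y
lineThrough-∋ = by-exhaustion (×-exhaustible K-exhaustible K-exhaustible)
  (λ (x , y) → ¬? (x ≟ᴷ y) →-dec (x ∈? lineThrough x y ×-dec y ∈? lineThrough x y))
  where
  _∈?_ : ∀ x L → Dec (x ∈[ linePoint ] L)
  x ∈? L = any? λ k → linePoint L k ≟ᴷ x

lineThrough-linePoint : ∀ t → let L , k , k′ = t in
                        linePoint L k ≢ linePoint L k′ → lineThrough (linePoint L k) (linePoint L k′) ≡ L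
lineThrough-linePoint = by-exhaustion (×-exhaustible Line-exhaustible (×-exhaustible all? all?))
  (λ (L , k , k′) → ¬? (linePoint L k ≟ᴷ linePoint L k′) →-dec
                    (lineThrough (linePoint L k) (linePoint L k′) ≟ᴸ L))
  where
  Line-exhaustible : Exhaustible Line
  Line-exhaustible = ⊎-exhaustible F₉-exhaustible K-exhaustible
  _≟ᴸ_ : DecidableEquality Line
  _≟ᴸ_ = ⊎-≡-dec F₉._≟_ _≟ᴷ_

affinePlane : Steiner₂ 9 K
affinePlane = record
  { Block           = Line
  ; point           = linePoint
  ; point-injective = λ L → ↔-to-injective Fin9↔F₉ ∘ onLine-injective L
  ; cover           = λ {x} {y} x≢y → lineThrough x y , lineThrough-∋ (x , y) x≢y
  ; unique          = λ x≢y x∈B y∈B x∈C y∈C → trans (sym (through x≢y x∈B y∈B)) (through x≢y x∈C y∈C)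
  }
  where
  through : ∀ {x y L} → x ≢ y → x ∈[ linePoint ] L → y ∈[ linePoint ] L → lineThrough x y ≡ L
  through {L = L} x≢y (k , refl) (k′ , refl) = lineThrough-linePoint (L , k , k′) x≢y

module ℤ₄₁ = Modular 41

open RelativeDifferenceFamily K-isAbelianGroup ℤ₄₁.isAbelianGroup Fin._≟_
  using (G; difference; IsRelativeDifferenceFamily; develop)

elt : ℕ → ℕ → ℕ → ℕ → ℕ → G
elt a b c d e = ((a mod 3 , b mod 3) , (c mod 3 , d mod 3)) , e mod 41

baseBlocks : Vec (Vec G 9) 45
baseBlocks =
    (elt 0 0 0 0 0 ∷ elt 1 0 0 0 1 ∷ elt 0 2 1 1 27 ∷ elt 2 0 0 0 32 ∷ elt 0 1 2 2 3 ∷ elt 1 0 0 0 40 ∷ elt 0 2 1 1 14 ∷ elt 2 0 0 0 9 ∷ elt 0 1 2 2 38 ∷ []) ∷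
    (elt 0 0 0 0 0 ∷ elt 1 0 0 2 6 ∷ elt 1 0 1 2 39 ∷ elt 2 0 0 1 28 ∷ elt 2 0 2 1 18 ∷ elt 1 0 0 2 35 ∷ elt 1 0 1 2 2 ∷ elt 2 0 0 1 13 ∷ elt 2 0 2 1 23 ∷ []) ∷
    (elt 0 0 0 0 0 ∷ elt 1 0 1 0 36 ∷ elt 1 2 0 0 29 ∷ elt 2 0 2 0 4 ∷ elt 2 1 0 0 26 ∷ elt 1 0 1 0 5 ∷ elt 1 2 0 0 12 ∷ elt 2 0 2 0 37 ∷ elt 2 1 0 0 15 ∷ []) ∷
    (elt 0 0 0 0 0 ∷ elt 1 2 2 2 11 ∷ elt 2 1 0 2 10 ∷ elt 2 1 1 1 24 ∷ elt 1 2 0 1 33 ∷ elt 1 2 2 2 30 ∷ elt 2 1 0 2 31 ∷ elt 2 1 1 1 17 ∷ elt 1 2 0 1 8 ∷ []) ∷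
    (elt 0 0 0 0 0 ∷ elt 2 2 2 0 25 ∷ elt 1 2 1 2 19 ∷ elt 1 1 1 0 21 ∷ elt 2 1 2 1 34 ∷ elt 2 2 2 0 16 ∷ elt 1 2 1 2 22 ∷ elt 1 1 1 0 20 ∷ elt 2 1 2 1 7 ∷ []) ∷
    (elt 0 0 0 0 0 ∷ elt 0 2 0 0 36 ∷ elt 2 1 1 0 18 ∷ elt 1 0 1 1 34 ∷ elt 1 1 2 1 9 ∷ elt 0 1 2 1 6 ∷ elt 0 0 2 2 13 ∷ elt 2 0 1 2 31 ∷ elt 0 0 1 1 39 ∷ []) ∷
    (elt 0 0 0 0 0 ∷ elt 1 1 0 0 11 ∷ elt 1 1 2 1 26 ∷ elt 1 2 1 1 40 ∷ elt 0 0 0 1 13 ∷ elt 2 0 0 2 36 ∷ elt 0 1 2 1 37 ∷ elt 2 2 0 2 22 ∷ elt 0 2 1 2 29 ∷ []) ∷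
    (elt 0 0 0 0 0 ∷ elt 0 2 0 2 25 ∷ elt 0 0 0 1 33 ∷ elt 2 0 1 1 35 ∷ elt 0 0 2 2 37 ∷ elt 2 0 1 2 11 ∷ elt 2 0 0 2 17 ∷ elt 0 1 1 2 9 ∷ elt 1 0 0 1 10 ∷ []) ∷
    (elt 0 0 0 0 0 ∷ elt 1 1 1 1 27 ∷ elt 0 0 2 2 34 ∷ elt 2 2 1 0 5 ∷ elt 0 1 2 1 17 ∷ elt 2 2 0 2 25 ∷ elt 2 0 1 2 20 ∷ elt 2 1 0 1 13 ∷ elt 1 0 2 1 19 ∷ []) ∷
    (elt 0 0 0 0 0 ∷ elt 0 1 1 1 39 ∷ elt 0 1 2 1 40 ∷ elt 0 0 2 1 30 ∷ elt 2 0 0 2 20 ∷ elt 0 1 1 2 27 ∷ elt 2 2 0 2 38 ∷ elt 1 2 2 0 37 ∷ elt 1 1 0 1 32 ∷ []) ∷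
    (elt 0 0 0 0 0 ∷ elt 2 1 1 2 29 ∷ elt 2 0 0 2 35 ∷ elt 0 1 0 2 16 ∷ elt 2 0 1 2 38 ∷ elt 2 1 0 1 39 ∷ elt 0 1 1 2 23 ∷ elt 2 2 1 2 17 ∷ elt 0 2 2 1 28 ∷ []) ∷
    (elt 0 0 0 0 0 ∷ elt 1 1 0 2 10 ∷ elt 2 0 1 2 5 ∷ elt 2 2 1 1 14 ∷ elt 2 2 0 2 23 ∷ elt 1 2 2 0 29 ∷ elt 2 1 0 1 15 ∷ elt 0 0 0 2 20 ∷ elt 1 2 0 2 4 ∷ []) ∷
    (elt 0 0 0 0 0 ∷ elt 0 2 1 0 19 ∷ elt 2 2 0 2 30 ∷ elt 0 0 1 0 2 ∷ elt 0 1 1 2 15 ∷ elt 2 2 1 2 10 ∷ elt 1 2 2 0 8 ∷ elt 0 0 1 1 38 ∷ elt 2 1 1 0 24 ∷ []) ∷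
    (elt 0 0 0 0 0 ∷ elt 1 0 2 0 32 ∷ elt 0 1 1 2 16 ∷ elt 0 2 2 0 12 ∷ elt 2 1 0 1 8 ∷ elt 0 0 0 2 19 ∷ elt 2 2 1 2 7 ∷ elt 0 2 1 2 23 ∷ elt 1 1 2 1 21 ∷ []) ∷
    (elt 0 0 0 0 0 ∷ elt 1 1 1 2 28 ∷ elt 2 1 0 1 14 ∷ elt 1 2 1 0 31 ∷ elt 1 2 2 0 7 ∷ elt 0 0 1 1 32 ∷ elt 0 0 0 2 1 ∷ elt 1 0 0 1 15 ∷ elt 0 0 0 1 3 ∷ []) ∷
    (elt 0 0 0 0 0 ∷ elt 0 1 0 0 4 ∷ elt 1 2 2 0 2 ∷ elt 2 0 2 2 22 ∷ elt 2 2 1 2 1 ∷ elt 0 2 1 2 28 ∷ elt 0 0 1 1 6 ∷ elt 1 0 2 1 8 ∷ elt 0 0 2 2 18 ∷ []) ∷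
    (elt 0 0 0 0 0 ∷ elt 2 2 0 0 24 ∷ elt 2 2 1 2 12 ∷ elt 2 1 2 2 9 ∷ elt 0 0 0 2 6 ∷ elt 1 0 0 1 4 ∷ elt 0 2 1 2 36 ∷ elt 1 1 0 1 7 ∷ elt 0 1 2 1 26 ∷ []) ∷
    (elt 0 0 0 0 0 ∷ elt 0 1 0 1 21 ∷ elt 0 0 0 2 31 ∷ elt 1 0 2 2 13 ∷ elt 0 0 1 1 36 ∷ elt 1 0 2 1 24 ∷ elt 1 0 0 1 11 ∷ elt 0 2 2 1 1 ∷ elt 2 0 0 2 33 ∷ []) ∷
    (elt 0 0 0 0 0 ∷ elt 2 2 2 2 3 ∷ elt 0 0 1 1 22 ∷ elt 1 1 2 0 37 ∷ elt 0 2 1 2 11 ∷ elt 1 1 0 1 21 ∷ elt 1 0 2 1 25 ∷ elt 1 2 0 2 6 ∷ elt 2 0 1 2 34 ∷ []) ∷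
    (elt 0 0 0 0 0 ∷ elt 0 2 2 2 18 ∷ elt 0 2 1 2 9 ∷ elt 0 0 1 2 17 ∷ elt 1 0 0 1 25 ∷ elt 0 2 2 1 3 ∷ elt 1 1 0 1 27 ∷ elt 2 1 1 0 36 ∷ elt 2 2 0 2 40 ∷ []) ∷
    (elt 0 0 0 0 0 ∷ elt 1 2 2 1 26 ∷ elt 1 0 0 1 13 ∷ elt 0 2 0 1 20 ∷ elt 1 0 2 1 27 ∷ elt 1 2 0 2 18 ∷ elt 0 2 2 1 39 ∷ elt 1 1 2 1 11 ∷ elt 0 1 1 2 35 ∷ []) ∷
    (elt 0 0 0 0 0 ∷ elt 2 2 0 1 33 ∷ elt 1 0 2 1 37 ∷ elt 1 1 2 2 38 ∷ elt 1 1 0 1 39 ∷ elt 2 1 1 0 26 ∷ elt 1 2 0 2 29 ∷ elt 0 0 0 1 25 ∷ elt 2 1 0 1 5 ∷ []) ∷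
    (elt 0 0 0 0 0 ∷ elt 0 1 2 0 34 ∷ elt 1 1 0 1 17 ∷ elt 0 0 2 0 23 ∷ elt 0 2 2 1 29 ∷ elt 1 1 2 1 33 ∷ elt 2 1 1 0 10 ∷ elt 0 0 2 2 27 ∷ elt 1 2 2 0 30 ∷ []) ∷
    (elt 0 0 0 0 0 ∷ elt 2 0 1 0 40 ∷ elt 0 2 2 1 20 ∷ elt 0 1 1 0 15 ∷ elt 1 2 0 2 10 ∷ elt 0 0 0 1 34 ∷ elt 1 1 2 1 19 ∷ elt 0 1 2 1 39 ∷ elt 2 2 1 2 16 ∷ []) ∷
    (elt 0 0 0 0 0 ∷ elt 2 2 2 1 35 ∷ elt 1 2 0 2 38 ∷ elt 2 1 2 0 8 ∷ elt 2 1 1 0 19 ∷ elt 0 0 2 2 40 ∷ elt 0 0 0 1 32 ∷ elt 2 0 0 2 29 ∷ elt 0 0 0 2 14 ∷ []) ∷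
    (elt 0 0 0 0 0 ∷ elt 0 2 0 0 5 ∷ elt 2 1 1 0 23 ∷ elt 1 0 1 1 7 ∷ elt 1 1 2 1 32 ∷ elt 0 1 2 1 35 ∷ elt 0 0 2 2 28 ∷ elt 2 0 1 2 10 ∷ elt 0 0 1 1 2 ∷ []) ∷
    (elt 0 0 0 0 0 ∷ elt 1 1 0 0 30 ∷ elt 1 1 2 1 15 ∷ elt 1 2 1 1 1 ∷ elt 0 0 0 1 28 ∷ elt 2 0 0 2 5 ∷ elt 0 1 2 1 4 ∷ elt 2 2 0 2 19 ∷ elt 0 2 1 2 12 ∷ []) ∷
    (elt 0 0 0 0 0 ∷ elt 0 2 0 2 16 ∷ elt 0 0 0 1 8 ∷ elt 2 0 1 1 6 ∷ elt 0 0 2 2 4 ∷ elt 2 0 1 2 30 ∷ elt 2 0 0 2 24 ∷ elt 0 1 1 2 32 ∷ elt 1 0 0 1 31 ∷ []) ∷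
    (elt 0 0 0 0 0 ∷ elt 1 1 1 1 14 ∷ elt 0 0 2 2 7 ∷ elt 2 2 1 0 36 ∷ elt 0 1 2 1 24 ∷ elt 2 2 0 2 16 ∷ elt 2 0 1 2 21 ∷ elt 2 1 0 1 28 ∷ elt 1 0 2 1 22 ∷ []) ∷
    (elt 0 0 0 0 0 ∷ elt 0 1 1 1 2 ∷ elt 0 1 2 1 1 ∷ elt 0 0 2 1 11 ∷ elt 2 0 0 2 21 ∷ elt 0 1 1 2 14 ∷ elt 2 2 0 2 3 ∷ elt 1 2 2 0 4 ∷ elt 1 1 0 1 9 ∷ []) ∷
    (elt 0 0 0 0 0 ∷ elt 2 1 1 2 12 ∷ elt 2 0 0 2 6 ∷ elt 0 1 0 2 25 ∷ elt 2 0 1 2 3 ∷ elt 2 1 0 1 2 ∷ elt 0 1 1 2 18 ∷ elt 2 2 1 2 24 ∷ elt 0 2 2 1 13 ∷ []) ∷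
    (elt 0 0 0 0 0 ∷ elt 1 1 0 2 31 ∷ elt 2 0 1 2 36 ∷ elt 2 2 1 1 27 ∷ elt 2 2 0 2 18 ∷ elt 1 2 2 0 12 ∷ elt 2 1 0 1 26 ∷ elt 0 0 0 2 21 ∷ elt 1 2 0 2 37 ∷ []) ∷
    (elt 0 0 0 0 0 ∷ elt 0 2 1 0 22 ∷ elt 2 2 0 2 11 ∷ elt 0 0 1 0 39 ∷ elt 0 1 1 2 26 ∷ elt 2 2 1 2 31 ∷ elt 1 2 2 0 33 ∷ elt 0 0 1 1 3 ∷ elt 2 1 1 0 17 ∷ []) ∷
    (elt 0 0 0 0 0 ∷ elt 1 0 2 0 9 ∷ elt 0 1 1 2 25 ∷ elt 0 2 2 0 29 ∷ elt 2 1 0 1 33 ∷ elt 0 0 0 2 22 ∷ elt 2 2 1 2 34 ∷ elt 0 2 1 2 18 ∷ elt 1 1 2 1 20 ∷ []) ∷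
    (elt 0 0 0 0 0 ∷ elt 1 1 1 2 13 ∷ elt 2 1 0 1 27 ∷ elt 1 2 1 0 10 ∷ elt 1 2 2 0 34 ∷ elt 0 0 1 1 9 ∷ elt 0 0 0 2 40 ∷ elt 1 0 0 1 26 ∷ elt 0 0 0 1 38 ∷ []) ∷
    (elt 0 0 0 0 0 ∷ elt 0 1 0 0 37 ∷ elt 1 2 2 0 39 ∷ elt 2 0 2 2 19 ∷ elt 2 2 1 2 40 ∷ elt 0 2 1 2 13 ∷ elt 0 0 1 1 35 ∷ elt 1 0 2 1 33 ∷ elt 0 0 2 2 23 ∷ []) ∷
    (elt 0 0 0 0 0 ∷ elt 2 2 0 0 17 ∷ elt 2 2 1 2 29 ∷ elt 2 1 2 2 32 ∷ elt 0 0 0 2 35 ∷ elt 1 0 0 1 37 ∷ elt 0 2 1 2 5 ∷ elt 1 1 0 1 34 ∷ elt 0 1 2 1 15 ∷ []) ∷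
    (elt 0 0 0 0 0 ∷ elt 0 1 0 1 20 ∷ elt 0 0 0 2 10 ∷ elt 1 0 2 2 28 ∷ elt 0 0 1 1 5 ∷ elt 1 0 2 1 17 ∷ elt 1 0 0 1 30 ∷ elt 0 2 2 1 40 ∷ elt 2 0 0 2 8 ∷ []) ∷
    (elt 0 0 0 0 0 ∷ elt 2 2 2 2 38 ∷ elt 0 0 1 1 19 ∷ elt 1 1 2 0 4 ∷ elt 0 2 1 2 30 ∷ elt 1 1 0 1 20 ∷ elt 1 0 2 1 16 ∷ elt 1 2 0 2 35 ∷ elt 2 0 1 2 7 ∷ []) ∷
    (elt 0 0 0 0 0 ∷ elt 0 2 2 2 23 ∷ elt 0 2 1 2 32 ∷ elt 0 0 1 2 24 ∷ elt 1 0 0 1 16 ∷ elt 0 2 2 1 38 ∷ elt 1 1 0 1 14 ∷ elt 2 1 1 0 5 ∷ elt 2 2 0 2 1 ∷ []) ∷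
    (elt 0 0 0 0 0 ∷ elt 1 2 2 1 15 ∷ elt 1 0 0 1 28 ∷ elt 0 2 0 1 21 ∷ elt 1 0 2 1 14 ∷ elt 1 2 0 2 23 ∷ elt 0 2 2 1 2 ∷ elt 1 1 2 1 30 ∷ elt 0 1 1 2 6 ∷ []) ∷
    (elt 0 0 0 0 0 ∷ elt 2 2 0 1 8 ∷ elt 1 0 2 1 4 ∷ elt 1 1 2 2 3 ∷ elt 1 1 0 1 2 ∷ elt 2 1 1 0 15 ∷ elt 1 2 0 2 12 ∷ elt 0 0 0 1 16 ∷ elt 2 1 0 1 36 ∷ []) ∷
    (elt 0 0 0 0 0 ∷ elt 0 1 2 0 7 ∷ elt 1 1 0 1 24 ∷ elt 0 0 2 0 18 ∷ elt 0 2 2 1 12 ∷ elt 1 1 2 1 8 ∷ elt 2 1 1 0 31 ∷ elt 0 0 2 2 14 ∷ elt 1 2 2 0 11 ∷ []) ∷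
    (elt 0 0 0 0 0 ∷ elt 2 0 1 0 1 ∷ elt 0 2 2 1 21 ∷ elt 0 1 1 0 26 ∷ elt 1 2 0 2 31 ∷ elt 0 0 0 1 7 ∷ elt 1 1 2 1 22 ∷ elt 0 1 2 1 2 ∷ elt 2 2 1 2 25 ∷ []) ∷
    (elt 0 0 0 0 0 ∷ elt 2 2 2 1 6 ∷ elt 1 2 0 2 3 ∷ elt 2 1 2 0 33 ∷ elt 2 1 1 0 22 ∷ elt 0 0 2 2 1 ∷ elt 0 0 0 1 9 ∷ elt 2 0 0 2 12 ∷ elt 0 0 0 2 27 ∷ []) ∷ []

base : Fin 45 → Fin 9 → G
base r i = lookup (lookup baseBlocks r) i

-- Row e, column u holds 81 r + 9 i + j for the unique r and i ≢ j with
-- base r i − base r j = (u , e); row 0 is unused.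
differenceTable : Vec (Vec ℕ 81) 41
differenceTable =
    (0 ∷ 0 ∷ 0 ∷ 0 ∷ 0 ∷ 0 ∷ 0 ∷ 0 ∷ 0 ∷ 0 ∷ 0 ∷ 0 ∷ 0 ∷ 0 ∷ 0 ∷ 0 ∷ 0 ∷ 0 ∷ 0 ∷ 0 ∷ 0 ∷ 0 ∷ 0 ∷ 0 ∷ 0 ∷ 0 ∷ 0 ∷ 0 ∷ 0 ∷ 0 ∷ 0 ∷ 0 ∷ 0 ∷ 0 ∷ 0 ∷ 0 ∷ 0 ∷ 0 ∷ 0 ∷ 0 ∷ 0 ∷ 0 ∷ 0 ∷ 0 ∷ 0 ∷ 0 ∷ 0 ∷ 0 ∷ 0 ∷ 0 ∷ 0 ∷ 0 ∷ 0 ∷ 0 ∷ 0 ∷ 0 ∷ 0 ∷ 0 ∷ 0 ∷ 0 ∷ 0 ∷ 0 ∷ 0 ∷ 0 ∷ 0 ∷ 0 ∷ 0 ∷ 0 ∷ 0 ∷ 0 ∷ 0 ∷ 0 ∷ 0 ∷ 0 ∷ 0 ∷ 0 ∷ 0 ∷ 0 ∷ 0 ∷ 0 ∷ 0 ∷ []) ∷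
    (358 ∷ 2760 ∷ 1188 ∷ 748 ∷ 1949 ∷ 1740 ∷ 2360 ∷ 3352 ∷ 3609 ∷ 1657 ∷ 1730 ∷ 381 ∷ 2544 ∷ 2731 ∷ 3004 ∷ 3187 ∷ 2367 ∷ 859 ∷ 3253 ∷ 389 ∷ 3342 ∷ 1551 ∷ 2471 ∷ 731 ∷ 948 ∷ 1440 ∷ 1095 ∷ 9 ∷ 3448 ∷ 1858 ∷ 226 ∷ 620 ∷ 790 ∷ 1864 ∷ 710 ∷ 2873 ∷ 2779 ∷ 1547 ∷ 1363 ∷ 917 ∷ 3547 ∷ 2503 ∷ 3125 ∷ 2839 ∷ 545 ∷ 3539 ∷ 3518 ∷ 2786 ∷ 302 ∷ 2133 ∷ 744 ∷ 2464 ∷ 3389 ∷ 646 ∷ 5 ∷ 3446 ∷ 1796 ∷ 3492 ∷ 1237 ∷ 2346 ∷ 210 ∷ 2418 ∷ 2264 ∷ 1887 ∷ 1182 ∷ 1938 ∷ 876 ∷ 2258 ∷ 1753 ∷ 254 ∷ 2404 ∷ 489 ∷ 1199 ∷ 2959 ∷ 3231 ∷ 1481 ∷ 2157 ∷ 1251 ∷ 2585 ∷ 827 ∷ 1879 ∷ []) ∷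
    (14 ∷ 2816 ∷ 1212 ∷ 999 ∷ 2097 ∷ 3054 ∷ 2595 ∷ 1410 ∷ 413 ∷ 1597 ∷ 3469 ∷ 385 ∷ 1739 ∷ 2358 ∷ 1626 ∷ 3305 ∷ 3546 ∷ 2850 ∷ 3201 ∷ 353 ∷ 1825 ∷ 1645 ∷ 1270 ∷ 1870 ∷ 3343 ∷ 3294 ∷ 730 ∷ 3023 ∷ 3288 ∷ 2965 ∷ 1284 ∷ 606 ∷ 135 ∷ 2208 ∷ 1330 ∷ 1023 ∷ 2255 ∷ 3357 ∷ 2119 ∷ 804 ∷ 2053 ∷ 2413 ∷ 2854 ∷ 2314 ∷ 1130 ∷ 724 ∷ 269 ∷ 815 ∷ 3587 ∷ 53 ∷ 2752 ∷ 1233 ∷ 1369 ∷ 753 ∷ 1451 ∷ 1337 ∷ 1652 ∷ 596 ∷ 2651 ∷ 2982 ∷ 2896 ∷ 83 ∷ 2218 ∷ 2312 ∷ 2475 ∷ 285 ∷ 2837 ∷ 2405 ∷ 2933 ∷ 1991 ∷ 1124 ∷ 37 ∷ 619 ∷ 523 ∷ 1705 ∷ 1226 ∷ 2726 ∷ 662 ∷ 2384 ∷ 745 ∷ 417 ∷ []) ∷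
    (380 ∷ 1206 ∷ 2762 ∷ 848 ∷ 2655 ∷ 284 ∷ 2452 ∷ 260 ∷ 979 ∷ 1364 ∷ 1162 ∷ 3479 ∷ 2696 ∷ 478 ∷ 3164 ∷ 1317 ∷ 2397 ∷ 36 ∷ 2968 ∷ 1835 ∷ 2766 ∷ 2945 ∷ 8 ∷ 761 ∷ 1100 ∷ 1584 ∷ 2042 ∷ 446 ∷ 2091 ∷ 2005 ∷ 1514 ∷ 339 ∷ 1421 ∷ 3094 ∷ 814 ∷ 3575 ∷ 2578 ∷ 735 ∷ 2414 ∷ 3619 ∷ 3079 ∷ 2310 ∷ 519 ∷ 3561 ∷ 3348 ∷ 240 ∷ 1861 ∷ 3582 ∷ 2955 ∷ 3372 ∷ 2132 ∷ 1423 ∷ 1228 ∷ 3153 ∷ 2074 ∷ 3633 ∷ 439 ∷ 1522 ∷ 1963 ∷ 2466 ∷ 3102 ∷ 3073 ∷ 347 ∷ 184 ∷ 1946 ∷ 3473 ∷ 3011 ∷ 1493 ∷ 2872 ∷ 1327 ∷ 560 ∷ 1760 ∷ 934 ∷ 754 ∷ 2403 ∷ 2163 ∷ 1704 ∷ 1925 ∷ 1959 ∷ 706 ∷ 1467 ∷ []) ∷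
    (137 ∷ 3436 ∷ 1848 ∷ 104 ∷ 571 ∷ 2209 ∷ 96 ∷ 605 ∷ 2223 ∷ 1224 ∷ 985 ∷ 857 ∷ 3129 ∷ 2702 ∷ 1682 ∷ 2725 ∷ 2160 ∷ 1618 ∷ 2836 ∷ 2453 ∷ 2629 ∷ 1121 ∷ 3230 ∷ 492 ∷ 1517 ∷ 3318 ∷ 1074 ∷ 2910 ∷ 1341 ∷ 1716 ∷ 169 ∷ 1920 ∷ 1889 ∷ 691 ∷ 3339 ∷ 1592 ∷ 3475 ∷ 2768 ∷ 2067 ∷ 336 ∷ 2171 ∷ 919 ∷ 3105 ∷ 2154 ∷ 1084 ∷ 1831 ∷ 1762 ∷ 963 ∷ 3332 ∷ 17 ∷ 2859 ∷ 2412 ∷ 1279 ∷ 1178 ∷ 1250 ∷ 3376 ∷ 2921 ∷ 2335 ∷ 3236 ∷ 1703 ∷ 189 ∷ 3557 ∷ 3516 ∷ 3443 ∷ 2519 ∷ 3390 ∷ 736 ∷ 2830 ∷ 2851 ∷ 1720 ∷ 1271 ∷ 41 ∷ 1799 ∷ 463 ∷ 1180 ∷ 1461 ∷ 2712 ∷ 518 ∷ 392 ∷ 2523 ∷ 511 ∷ []) ∷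
    (157 ∷ 2658 ∷ 1006 ∷ 116 ∷ 3033 ∷ 1415 ∷ 124 ∷ 3019 ∷ 1381 ∷ 406 ∷ 3439 ∷ 3263 ∷ 2327 ∷ 1884 ∷ 888 ∷ 1931 ∷ 1302 ∷ 800 ∷ 2034 ∷ 1667 ∷ 1795 ∷ 3535 ∷ 2428 ∷ 2970 ∷ 699 ∷ 2492 ∷ 3512 ∷ 2060 ∷ 491 ∷ 946 ∷ 207 ∷ 1086 ∷ 1127 ∷ 3145 ∷ 2513 ∷ 806 ∷ 2609 ∷ 1990 ∷ 1273 ∷ 340 ∷ 1321 ∷ 3333 ∷ 2271 ∷ 1328 ∷ 3522 ∷ 1013 ∷ 960 ∷ 3329 ∷ 2530 ∷ 61 ∷ 2081 ∷ 1546 ∷ 421 ∷ 3640 ∷ 480 ∷ 2526 ∷ 2151 ∷ 1501 ∷ 2402 ∷ 909 ∷ 163 ∷ 2699 ∷ 2730 ∷ 2641 ∷ 1773 ∷ 2572 ∷ 3222 ∷ 1988 ∷ 2089 ∷ 902 ∷ 429 ∷ 29 ∷ 1045 ∷ 2877 ∷ 3578 ∷ 675 ∷ 1894 ∷ 2964 ∷ 356 ∷ 1729 ∷ 2981 ∷ []) ∷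
    (44 ∷ 2920 ∷ 1332 ∷ 2238 ∷ 1269 ∷ 3206 ∷ 626 ∷ 1562 ∷ 2841 ∷ 2584 ∷ 1280 ∷ 3433 ∷ 2441 ∷ 3628 ∷ 3312 ∷ 3040 ∷ 450 ∷ 998 ∷ 908 ∷ 1821 ∷ 2860 ∷ 1444 ∷ 2666 ∷ 2030 ∷ 829 ∷ 1628 ∷ 1960 ∷ 2485 ∷ 812 ∷ 90 ∷ 1939 ∷ 335 ∷ 2552 ∷ 1632 ∷ 3529 ∷ 570 ∷ 3334 ∷ 791 ∷ 1834 ∷ 2339 ∷ 3423 ∷ 1945 ∷ 2954 ∷ 957 ∷ 75 ∷ 871 ∷ 1968 ∷ 1521 ∷ 1029 ∷ 701 ∷ 2019 ∷ 1263 ∷ 1176 ∷ 307 ∷ 825 ∷ 86 ∷ 2448 ∷ 3268 ∷ 2214 ∷ 1877 ∷ 3527 ∷ 940 ∷ 383 ∷ 2499 ∷ 3085 ∷ 3620 ∷ 2867 ∷ 291 ∷ 2812 ∷ 2625 ∷ 3599 ∷ 2345 ∷ 1738 ∷ 3470 ∷ 2427 ∷ 1318 ∷ 67 ∷ 2545 ∷ 727 ∷ 3573 ∷ 1811 ∷ []) ∷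
    (277 ∷ 3528 ∷ 1868 ∷ 867 ∷ 650 ∷ 308 ∷ 2463 ∷ 300 ∷ 2286 ∷ 1118 ∷ 1798 ∷ 2076 ∷ 173 ∷ 1672 ∷ 1101 ∷ 3411 ∷ 1715 ∷ 2337 ∷ 2698 ∷ 464 ∷ 3466 ∷ 1783 ∷ 709 ∷ 3367 ∷ 221 ∷ 2705 ∷ 3308 ∷ 1777 ∷ 629 ∷ 145 ∷ 565 ∷ 2052 ∷ 3458 ∷ 2422 ∷ 1466 ∷ 3044 ∷ 3261 ∷ 1359 ∷ 1470 ∷ 778 ∷ 2650 ∷ 1576 ∷ 1659 ∷ 2679 ∷ 2279 ∷ 1857 ∷ 2323 ∷ 795 ∷ 2183 ∷ 1156 ∷ 328 ∷ 1170 ∷ 2878 ∷ 2504 ∷ 3365 ∷ 129 ∷ 2265 ∷ 746 ∷ 1400 ∷ 3150 ∷ 2177 ∷ 1806 ∷ 408 ∷ 3437 ∷ 2383 ∷ 663 ∷ 2758 ∷ 836 ∷ 1282 ∷ 539 ∷ 396 ∷ 2792 ∷ 1649 ∷ 3106 ∷ 2923 ∷ 3271 ∷ 667 ∷ 1107 ∷ 2390 ∷ 3172 ∷ 1014 ∷ []) ∷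
    (196 ∷ 2205 ∷ 569 ∷ 140 ∷ 3286 ∷ 3623 ∷ 92 ∷ 1995 ∷ 1634 ∷ 1568 ∷ 933 ∷ 586 ∷ 458 ∷ 1201 ∷ 2302 ∷ 665 ∷ 2184 ∷ 1725 ∷ 3180 ∷ 2198 ∷ 2569 ∷ 2341 ∷ 3377 ∷ 548 ∷ 2102 ∷ 714 ∷ 2797 ∷ 64 ∷ 1385 ∷ 484 ∷ 2423 ∷ 1075 ∷ 1776 ∷ 1495 ∷ 1278 ∷ 1578 ∷ 3385 ∷ 2624 ∷ 1702 ∷ 2256 ∷ 1591 ∷ 1037 ∷ 227 ∷ 3447 ∷ 2382 ∷ 582 ∷ 315 ∷ 2677 ∷ 3567 ∷ 1319 ∷ 3284 ∷ 1026 ∷ 3025 ∷ 2309 ∷ 48 ∷ 2096 ∷ 3069 ∷ 3091 ∷ 3190 ∷ 2842 ∷ 755 ∷ 3356 ∷ 2711 ∷ 2242 ∷ 1089 ∷ 247 ∷ 2598 ∷ 697 ∷ 1389 ∷ 1971 ∷ 1696 ∷ 2963 ∷ 1717 ∷ 3330 ∷ 1020 ∷ 219 ∷ 786 ∷ 1787 ∷ 628 ∷ 2617 ∷ 3227 ∷ []) ∷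
    (338 ∷ 3618 ∷ 1950 ∷ 1550 ∷ 2799 ∷ 2542 ∷ 3178 ∷ 930 ∷ 1139 ∷ 2443 ∷ 2532 ∷ 377 ∷ 3378 ∷ 3525 ∷ 630 ∷ 741 ∷ 3161 ∷ 1661 ∷ 847 ∷ 361 ∷ 920 ∷ 2377 ∷ 3289 ∷ 1557 ∷ 1734 ∷ 2194 ∷ 1921 ∷ 3 ∷ 986 ∷ 2636 ∷ 190 ∷ 1454 ∷ 1608 ∷ 2682 ∷ 1536 ∷ 427 ∷ 3629 ∷ 2421 ∷ 2149 ∷ 1775 ∷ 1069 ∷ 3257 ∷ 671 ∷ 441 ∷ 1347 ∷ 1077 ∷ 1128 ∷ 3612 ∷ 314 ∷ 2919 ∷ 1594 ∷ 3306 ∷ 943 ∷ 1448 ∷ 63 ∷ 1048 ∷ 2638 ∷ 1054 ∷ 2063 ∷ 3140 ∷ 214 ∷ 3220 ∷ 3050 ∷ 2729 ∷ 1976 ∷ 2708 ∷ 1654 ∷ 3076 ∷ 2579 ∷ 282 ∷ 3174 ∷ 1323 ∷ 1969 ∷ 553 ∷ 737 ∷ 2315 ∷ 2975 ∷ 2029 ∷ 3347 ∷ 1693 ∷ 2737 ∷ []) ∷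
    (208 ∷ 1379 ∷ 3015 ∷ 112 ∷ 2444 ∷ 2805 ∷ 160 ∷ 1193 ∷ 856 ∷ 750 ∷ 3379 ∷ 3008 ∷ 2912 ∷ 3607 ∷ 1524 ∷ 3151 ∷ 1358 ∷ 947 ∷ 2378 ∷ 1396 ∷ 1743 ∷ 1475 ∷ 2535 ∷ 2994 ∷ 1268 ∷ 3112 ∷ 2011 ∷ 68 ∷ 639 ∷ 2906 ∷ 1565 ∷ 3521 ∷ 926 ∷ 661 ∷ 412 ∷ 760 ∷ 2527 ∷ 1830 ∷ 900 ∷ 1438 ∷ 797 ∷ 3427 ∷ 239 ∷ 2597 ∷ 1596 ∷ 3052 ∷ 249 ∷ 1899 ∷ 2781 ∷ 533 ∷ 2506 ∷ 3408 ∷ 2199 ∷ 1507 ∷ 12 ∷ 1294 ∷ 2195 ∷ 2305 ∷ 2388 ∷ 2088 ∷ 3233 ∷ 2586 ∷ 1885 ∷ 1392 ∷ 3487 ∷ 261 ∷ 1836 ∷ 3119 ∷ 595 ∷ 1137 ∷ 854 ∷ 2129 ∷ 955 ∷ 2512 ∷ 3434 ∷ 175 ∷ 3192 ∷ 1017 ∷ 3066 ∷ 1847 ∷ 2401 ∷ []) ∷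
    (206 ∷ 3029 ∷ 1425 ∷ 3595 ∷ 2707 ∷ 732 ∷ 1983 ∷ 2376 ∷ 1119 ∷ 1794 ∷ 2746 ∷ 1480 ∷ 237 ∷ 3022 ∷ 2039 ∷ 1338 ∷ 3082 ∷ 58 ∷ 3430 ∷ 3116 ∷ 1070 ∷ 2974 ∷ 74 ∷ 1494 ∷ 229 ∷ 451 ∷ 1442 ∷ 2130 ∷ 1431 ∷ 521 ∷ 2647 ∷ 2603 ∷ 889 ∷ 1996 ∷ 2192 ∷ 150 ∷ 495 ∷ 974 ∷ 550 ∷ 449 ∷ 3496 ∷ 1606 ∷ 2507 ∷ 1683 ∷ 3368 ∷ 2828 ∷ 1102 ∷ 953 ∷ 2400 ∷ 2787 ∷ 1033 ∷ 3474 ∷ 1973 ∷ 252 ∷ 542 ∷ 2181 ∷ 3003 ∷ 3632 ∷ 102 ∷ 612 ∷ 987 ∷ 2501 ∷ 991 ∷ 1160 ∷ 2589 ∷ 2714 ∷ 1790 ∷ 248 ∷ 3585 ∷ 788 ∷ 2661 ∷ 1191 ∷ 2107 ∷ 2122 ∷ 2610 ∷ 863 ∷ 1724 ∷ 3247 ∷ 2101 ∷ 3202 ∷ 1900 ∷ []) ∷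
    (95 ∷ 2395 ∷ 743 ∷ 2807 ∷ 1293 ∷ 2935 ∷ 1211 ∷ 1307 ∷ 2897 ∷ 2494 ∷ 700 ∷ 1491 ∷ 2676 ∷ 2134 ∷ 1786 ∷ 604 ∷ 494 ∷ 885 ∷ 826 ∷ 3135 ∷ 2336 ∷ 2200 ∷ 2465 ∷ 2178 ∷ 1080 ∷ 3438 ∷ 498 ∷ 1205 ∷ 1951 ∷ 3104 ∷ 3046 ∷ 2072 ∷ 1351 ∷ 1726 ∷ 3369 ∷ 118 ∷ 3282 ∷ 1411 ∷ 3014 ∷ 2486 ∷ 1906 ∷ 2289 ∷ 1104 ∷ 2918 ∷ 39 ∷ 216 ∷ 2393 ∷ 3375 ∷ 3424 ∷ 687 ∷ 366 ∷ 2556 ∷ 811 ∷ 1365 ∷ 2833 ∷ 1532 ∷ 3627 ∷ 3386 ∷ 134 ∷ 1733 ∷ 1418 ∷ 2931 ∷ 428 ∷ 164 ∷ 1707 ∷ 805 ∷ 896 ∷ 2977 ∷ 2439 ∷ 1820 ∷ 350 ∷ 2299 ∷ 1678 ∷ 1450 ∷ 3063 ∷ 2732 ∷ 71 ∷ 1314 ∷ 834 ∷ 677 ∷ 3550 ∷ []) ∷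
    (24 ∷ 522 ∷ 2110 ∷ 3056 ∷ 2031 ∷ 752 ∷ 1428 ∷ 2396 ∷ 459 ∷ 3338 ∷ 2050 ∷ 1011 ∷ 3259 ∷ 1150 ∷ 818 ∷ 634 ∷ 1220 ∷ 1856 ∷ 1774 ∷ 2623 ∷ 470 ∷ 2230 ∷ 3428 ∷ 2880 ∷ 1631 ∷ 2502 ∷ 2818 ∷ 3255 ∷ 1638 ∷ 84 ∷ 2717 ∷ 363 ∷ 3370 ∷ 2458 ∷ 1067 ∷ 1404 ∷ 928 ∷ 1617 ∷ 2660 ∷ 3157 ∷ 1001 ∷ 2763 ∷ 508 ∷ 1735 ∷ 47 ∷ 1689 ∷ 2810 ∷ 2275 ∷ 1815 ∷ 1535 ∷ 2789 ∷ 2057 ∷ 2002 ∷ 271 ∷ 1675 ∷ 144 ∷ 3242 ∷ 822 ∷ 3000 ∷ 2719 ∷ 1129 ∷ 1742 ∷ 395 ∷ 3301 ∷ 711 ∷ 1158 ∷ 453 ∷ 295 ∷ 3606 ∷ 3459 ∷ 1209 ∷ 3131 ∷ 2524 ∷ 1024 ∷ 3221 ∷ 2144 ∷ 55 ∷ 3387 ∷ 1529 ∷ 1135 ∷ 2613 ∷ []) ∷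
    (400 ∷ 3572 ∷ 2016 ∷ 3262 ∷ 1789 ∷ 272 ∷ 1658 ∷ 304 ∷ 3465 ∷ 538 ∷ 3576 ∷ 2645 ∷ 1910 ∷ 2852 ∷ 2394 ∷ 515 ∷ 1571 ∷ 2 ∷ 2174 ∷ 1049 ∷ 1972 ∷ 2127 ∷ 54 ∷ 3207 ∷ 3506 ∷ 734 ∷ 1288 ∷ 2884 ∷ 1249 ∷ 1203 ∷ 672 ∷ 367 ∷ 643 ∷ 2332 ∷ 3276 ∷ 2773 ∷ 1744 ∷ 3213 ∷ 1564 ∷ 2769 ∷ 2277 ∷ 1516 ∷ 2973 ∷ 2735 ∷ 2514 ∷ 204 ∷ 1043 ∷ 2756 ∷ 2137 ∷ 2570 ∷ 1370 ∷ 581 ∷ 442 ∷ 2303 ∷ 1256 ∷ 2815 ∷ 2901 ∷ 664 ∷ 1145 ∷ 1624 ∷ 2324 ∷ 2231 ∷ 359 ∷ 188 ∷ 1152 ∷ 2671 ∷ 2233 ∷ 723 ∷ 2038 ∷ 525 ∷ 2942 ∷ 942 ∷ 3388 ∷ 3224 ∷ 1545 ∷ 1329 ∷ 918 ∷ 1131 ∷ 1189 ∷ 3120 ∷ 649 ∷ []) ∷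
    (115 ∷ 1553 ∷ 3205 ∷ 2021 ∷ 467 ∷ 2117 ∷ 3617 ∷ 505 ∷ 2103 ∷ 1636 ∷ 3146 ∷ 705 ∷ 1890 ∷ 1308 ∷ 1008 ∷ 3010 ∷ 2988 ∷ 3275 ∷ 3304 ∷ 2301 ∷ 1510 ∷ 1414 ∷ 1695 ∷ 1304 ∷ 3486 ∷ 2596 ∷ 2944 ∷ 3643 ∷ 1197 ∷ 2342 ∷ 2228 ∷ 1238 ∷ 501 ∷ 956 ∷ 2543 ∷ 146 ∷ 2488 ∷ 633 ∷ 2260 ∷ 1644 ∷ 1120 ∷ 1487 ∷ 3542 ∷ 2124 ∷ 11 ∷ 166 ∷ 1615 ∷ 2517 ∷ 2630 ∷ 3109 ∷ 362 ∷ 1706 ∷ 3249 ∷ 547 ∷ 2015 ∷ 674 ∷ 2761 ∷ 2536 ∷ 138 ∷ 939 ∷ 616 ∷ 2161 ∷ 2882 ∷ 234 ∷ 945 ∷ 3203 ∷ 3366 ∷ 2175 ∷ 1621 ∷ 994 ∷ 386 ∷ 1497 ∷ 852 ∷ 584 ∷ 2221 ∷ 1914 ∷ 59 ∷ 488 ∷ 3296 ∷ 3099 ∷ 2716 ∷ []) ∷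
    (319 ∷ 3384 ∷ 1708 ∷ 3425 ∷ 3126 ∷ 968 ∷ 1829 ∷ 2564 ∷ 1490 ∷ 3307 ∷ 568 ∷ 837 ∷ 444 ∷ 1957 ∷ 1071 ∷ 583 ∷ 2820 ∷ 2150 ∷ 1663 ∷ 2433 ∷ 2196 ∷ 2251 ∷ 562 ∷ 1168 ∷ 2056 ∷ 2675 ∷ 3601 ∷ 1122 ∷ 3195 ∷ 591 ∷ 2222 ∷ 2489 ∷ 123 ∷ 1435 ∷ 3132 ∷ 2892 ∷ 1891 ∷ 653 ∷ 2046 ∷ 325 ∷ 2771 ∷ 457 ∷ 191 ∷ 3491 ∷ 1577 ∷ 2590 ∷ 2861 ∷ 2152 ∷ 278 ∷ 1064 ∷ 1175 ∷ 1050 ∷ 3143 ∷ 1108 ∷ 2734 ∷ 2243 ∷ 1543 ∷ 3039 ∷ 1248 ∷ 1464 ∷ 642 ∷ 107 ∷ 861 ∷ 962 ∷ 500 ∷ 1289 ∷ 2654 ∷ 2688 ∷ 1483 ∷ 286 ∷ 2803 ∷ 2692 ∷ 3495 ∷ 434 ∷ 2313 ∷ 223 ∷ 3181 ∷ 1935 ∷ 369 ∷ 2093 ∷ 1207 ∷ []) ∷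
    (186 ∷ 615 ∷ 2219 ∷ 1173 ∷ 3549 ∷ 1566 ∷ 2785 ∷ 3162 ∷ 1897 ∷ 2620 ∷ 3500 ∷ 2306 ∷ 209 ∷ 632 ∷ 2881 ∷ 2164 ∷ 684 ∷ 62 ∷ 984 ∷ 670 ∷ 1936 ∷ 528 ∷ 38 ∷ 2272 ∷ 217 ∷ 1229 ∷ 2212 ∷ 2972 ∷ 2193 ∷ 1371 ∷ 3417 ∷ 3421 ∷ 1691 ∷ 2822 ∷ 3042 ∷ 154 ∷ 1297 ∷ 1800 ∷ 1312 ∷ 1291 ∷ 1090 ∷ 2392 ∷ 3293 ∷ 2437 ∷ 914 ∷ 3590 ∷ 1904 ∷ 1779 ∷ 3218 ∷ 3621 ∷ 1851 ∷ 980 ∷ 2775 ∷ 246 ∷ 1320 ∷ 2951 ∷ 621 ∷ 1186 ∷ 130 ∷ 1382 ∷ 1837 ∷ 3319 ∷ 1793 ∷ 2018 ∷ 3383 ∷ 3532 ∷ 2664 ∷ 306 ∷ 1163 ∷ 1590 ∷ 3463 ∷ 1977 ∷ 2925 ∷ 2980 ∷ 3404 ∷ 1697 ∷ 2558 ∷ 873 ∷ 2879 ∷ 796 ∷ 2686 ∷ []) ∷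
    (66 ∷ 3642 ∷ 2006 ∷ 1785 ∷ 2843 ∷ 600 ∷ 3429 ∷ 2244 ∷ 1287 ∷ 2391 ∷ 1015 ∷ 341 ∷ 2533 ∷ 3160 ∷ 2484 ∷ 835 ∷ 1060 ∷ 460 ∷ 787 ∷ 365 ∷ 2659 ∷ 2495 ∷ 2040 ∷ 2736 ∷ 929 ∷ 816 ∷ 1548 ∷ 641 ∷ 842 ∷ 527 ∷ 2086 ∷ 1408 ∷ 89 ∷ 3026 ∷ 2172 ∷ 1841 ∷ 3049 ∷ 895 ∷ 2953 ∷ 1574 ∷ 2847 ∷ 3175 ∷ 416 ∷ 3092 ∷ 1916 ∷ 1502 ∷ 265 ∷ 1665 ∷ 1181 ∷ 25 ∷ 3554 ∷ 2027 ∷ 2123 ∷ 1595 ∷ 2213 ∷ 2155 ∷ 2478 ∷ 1398 ∷ 3453 ∷ 520 ∷ 474 ∷ 117 ∷ 3036 ∷ 3154 ∷ 3245 ∷ 321 ∷ 423 ∷ 3183 ∷ 559 ∷ 2777 ∷ 1942 ∷ 33 ∷ 1445 ∷ 1309 ∷ 2547 ∷ 2044 ∷ 3560 ∷ 1504 ∷ 3234 ∷ 1603 ∷ 1243 ∷ []) ∷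
    (289 ∷ 2678 ∷ 1098 ∷ 3273 ∷ 3096 ∷ 320 ∷ 1677 ∷ 256 ∷ 1460 ∷ 3508 ∷ 1036 ∷ 1274 ∷ 241 ∷ 878 ∷ 3515 ∷ 2593 ∷ 937 ∷ 1519 ∷ 1928 ∷ 2886 ∷ 2608 ∷ 981 ∷ 3147 ∷ 2525 ∷ 193 ∷ 1911 ∷ 2482 ∷ 935 ∷ 3075 ∷ 149 ∷ 2987 ∷ 1218 ∷ 2616 ∷ 1556 ∷ 720 ∷ 2210 ∷ 2459 ∷ 493 ∷ 676 ∷ 3200 ∷ 1824 ∷ 742 ∷ 841 ∷ 1917 ∷ 1477 ∷ 1007 ∷ 1473 ∷ 3193 ∷ 1349 ∷ 3602 ∷ 342 ∷ 3568 ∷ 2092 ∷ 1646 ∷ 2587 ∷ 93 ∷ 1439 ∷ 3232 ∷ 614 ∷ 2276 ∷ 1375 ∷ 1028 ∷ 2862 ∷ 2667 ∷ 1605 ∷ 3133 ∷ 1980 ∷ 3314 ∷ 448 ∷ 2993 ∷ 330 ∷ 1966 ∷ 831 ∷ 2280 ∷ 2169 ∷ 2469 ∷ 3089 ∷ 3489 ∷ 1588 ∷ 2386 ∷ 3460 ∷ []) ∷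
    (267 ∷ 2518 ∷ 954 ∷ 2639 ∷ 2300 ∷ 3374 ∷ 995 ∷ 1778 ∷ 696 ∷ 2473 ∷ 3006 ∷ 3243 ∷ 2866 ∷ 1171 ∷ 3485 ∷ 3061 ∷ 1978 ∷ 1372 ∷ 877 ∷ 1647 ∷ 1378 ∷ 1393 ∷ 2960 ∷ 3630 ∷ 1254 ∷ 1881 ∷ 2767 ∷ 3544 ∷ 2353 ∷ 3053 ∷ 1452 ∷ 1671 ∷ 119 ∷ 609 ∷ 2274 ∷ 2058 ∷ 1065 ∷ 3123 ∷ 1244 ∷ 387 ∷ 2017 ∷ 2903 ∷ 235 ∷ 2745 ∷ 751 ∷ 1772 ∷ 2099 ∷ 1310 ∷ 298 ∷ 3502 ∷ 3613 ∷ 3464 ∷ 2293 ∷ 3498 ∷ 1932 ∷ 1401 ∷ 765 ∷ 2245 ∷ 462 ∷ 702 ∷ 3032 ∷ 143 ∷ 3299 ∷ 3400 ∷ 2962 ∷ 431 ∷ 1860 ∷ 1918 ∷ 713 ∷ 290 ∷ 1985 ∷ 1874 ∷ 2701 ∷ 2856 ∷ 1463 ∷ 211 ∷ 2387 ∷ 1061 ∷ 327 ∷ 1267 ∷ 3581 ∷ []) ∷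
    (299 ∷ 898 ∷ 2574 ∷ 1019 ∷ 680 ∷ 1754 ∷ 2615 ∷ 3398 ∷ 2316 ∷ 853 ∷ 1386 ∷ 1623 ∷ 1246 ∷ 2791 ∷ 1865 ∷ 1441 ∷ 3598 ∷ 2992 ∷ 2497 ∷ 3267 ∷ 2998 ∷ 3013 ∷ 1340 ∷ 2010 ∷ 2874 ∷ 3501 ∷ 1147 ∷ 1924 ∷ 733 ∷ 1433 ∷ 3072 ∷ 3291 ∷ 159 ∷ 2229 ∷ 654 ∷ 438 ∷ 2685 ∷ 1503 ∷ 2864 ∷ 351 ∷ 3637 ∷ 1283 ∷ 203 ∷ 1125 ∷ 2371 ∷ 3392 ∷ 479 ∷ 2930 ∷ 266 ∷ 1882 ∷ 1993 ∷ 1844 ∷ 673 ∷ 1878 ∷ 3552 ∷ 3021 ∷ 2385 ∷ 625 ∷ 2082 ∷ 2322 ∷ 1412 ∷ 103 ∷ 1679 ∷ 1780 ∷ 1342 ∷ 2051 ∷ 3480 ∷ 3538 ∷ 2333 ∷ 258 ∷ 3605 ∷ 3494 ∷ 1081 ∷ 1236 ∷ 3083 ∷ 179 ∷ 767 ∷ 2681 ∷ 331 ∷ 2887 ∷ 1961 ∷ []) ∷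
    (257 ∷ 1058 ∷ 2718 ∷ 1653 ∷ 1476 ∷ 280 ∷ 3297 ∷ 296 ∷ 3080 ∷ 1888 ∷ 2656 ∷ 2894 ∷ 201 ∷ 2498 ∷ 1895 ∷ 973 ∷ 2557 ∷ 3139 ∷ 3548 ∷ 1266 ∷ 988 ∷ 2601 ∷ 1527 ∷ 905 ∷ 233 ∷ 3531 ∷ 862 ∷ 2555 ∷ 1455 ∷ 109 ∷ 1367 ∷ 2838 ∷ 996 ∷ 3176 ∷ 2340 ∷ 590 ∷ 839 ∷ 2113 ∷ 2296 ∷ 1580 ∷ 3444 ∷ 2362 ∷ 2461 ∷ 3537 ∷ 3097 ∷ 2627 ∷ 3093 ∷ 1573 ∷ 2969 ∷ 1982 ∷ 378 ∷ 1948 ∷ 472 ∷ 3266 ∷ 967 ∷ 133 ∷ 3059 ∷ 1612 ∷ 2234 ∷ 656 ∷ 2995 ∷ 2648 ∷ 1242 ∷ 1047 ∷ 3225 ∷ 1513 ∷ 3600 ∷ 1694 ∷ 2068 ∷ 1373 ∷ 326 ∷ 3586 ∷ 2451 ∷ 660 ∷ 549 ∷ 849 ∷ 1469 ∷ 1869 ∷ 3208 ∷ 766 ∷ 1840 ∷ []) ∷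
    (34 ∷ 2022 ∷ 3626 ∷ 3405 ∷ 1223 ∷ 2220 ∷ 1809 ∷ 624 ∷ 2907 ∷ 771 ∷ 2635 ∷ 373 ∷ 913 ∷ 1540 ∷ 864 ∷ 2455 ∷ 2680 ∷ 2080 ∷ 2407 ∷ 397 ∷ 1039 ∷ 875 ∷ 420 ∷ 1116 ∷ 2549 ∷ 2436 ∷ 3168 ∷ 2261 ∷ 2462 ∷ 2147 ∷ 466 ∷ 3028 ∷ 85 ∷ 1406 ∷ 552 ∷ 3461 ∷ 1429 ∷ 2515 ∷ 1333 ∷ 3194 ∷ 1227 ∷ 1555 ∷ 2036 ∷ 1472 ∷ 3536 ∷ 3122 ∷ 305 ∷ 3285 ∷ 2801 ∷ 57 ∷ 1934 ∷ 407 ∷ 503 ∷ 3215 ∷ 593 ∷ 535 ∷ 858 ∷ 3018 ∷ 1833 ∷ 2140 ∷ 2094 ∷ 153 ∷ 1416 ∷ 1534 ∷ 1625 ∷ 281 ∷ 2043 ∷ 1563 ∷ 2179 ∷ 1157 ∷ 3562 ∷ 65 ∷ 3065 ∷ 2929 ∷ 927 ∷ 424 ∷ 1940 ∷ 3124 ∷ 1614 ∷ 3223 ∷ 2863 ∷ []) ∷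
    (218 ∷ 2235 ∷ 599 ∷ 2793 ∷ 1929 ∷ 3186 ∷ 1165 ∷ 1542 ∷ 3517 ∷ 1000 ∷ 1880 ∷ 686 ∷ 177 ∷ 2252 ∷ 1261 ∷ 544 ∷ 2304 ∷ 22 ∷ 2604 ∷ 2290 ∷ 3556 ∷ 2148 ∷ 78 ∷ 652 ∷ 185 ∷ 2849 ∷ 592 ∷ 1352 ∷ 573 ∷ 2991 ∷ 1797 ∷ 1801 ∷ 3311 ∷ 1202 ∷ 1422 ∷ 122 ∷ 2917 ∷ 3420 ∷ 2932 ∷ 2911 ∷ 2710 ∷ 772 ∷ 1673 ∷ 817 ∷ 2534 ∷ 1970 ∷ 3524 ∷ 3399 ∷ 1598 ∷ 2001 ∷ 3471 ∷ 2600 ∷ 1155 ∷ 250 ∷ 2940 ∷ 1331 ∷ 2241 ∷ 2806 ∷ 98 ∷ 3002 ∷ 3457 ∷ 1699 ∷ 3413 ∷ 3638 ∷ 1763 ∷ 1912 ∷ 1044 ∷ 270 ∷ 2783 ∷ 3210 ∷ 1843 ∷ 3597 ∷ 1305 ∷ 1360 ∷ 1784 ∷ 3317 ∷ 938 ∷ 2493 ∷ 1259 ∷ 2416 ∷ 1066 ∷ []) ∷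
    (287 ∷ 1764 ∷ 3328 ∷ 1805 ∷ 1506 ∷ 2588 ∷ 3449 ∷ 944 ∷ 3110 ∷ 1687 ∷ 2188 ∷ 2457 ∷ 2064 ∷ 3577 ∷ 2691 ∷ 2203 ∷ 1200 ∷ 530 ∷ 3283 ∷ 813 ∷ 576 ∷ 631 ∷ 2182 ∷ 2788 ∷ 436 ∷ 1055 ∷ 1981 ∷ 2742 ∷ 1575 ∷ 2211 ∷ 602 ∷ 869 ∷ 155 ∷ 3055 ∷ 1512 ∷ 1272 ∷ 3511 ∷ 2273 ∷ 426 ∷ 329 ∷ 1151 ∷ 2077 ∷ 231 ∷ 1871 ∷ 3197 ∷ 970 ∷ 1241 ∷ 532 ∷ 310 ∷ 2684 ∷ 2795 ∷ 2670 ∷ 1523 ∷ 2728 ∷ 1114 ∷ 623 ∷ 3163 ∷ 1419 ∷ 2868 ∷ 3084 ∷ 2262 ∷ 139 ∷ 2481 ∷ 2582 ∷ 2120 ∷ 2909 ∷ 1034 ∷ 1068 ∷ 3103 ∷ 318 ∷ 1183 ∷ 1072 ∷ 1875 ∷ 2054 ∷ 693 ∷ 183 ∷ 1561 ∷ 3555 ∷ 333 ∷ 473 ∷ 2827 ∷ []) ∷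
    (147 ∷ 3173 ∷ 1585 ∷ 3641 ∷ 2087 ∷ 497 ∷ 1997 ∷ 2125 ∷ 483 ∷ 3256 ∷ 1526 ∷ 2325 ∷ 3510 ∷ 2928 ∷ 2628 ∷ 1390 ∷ 1368 ∷ 1655 ∷ 1684 ∷ 681 ∷ 3130 ∷ 3034 ∷ 3315 ∷ 2924 ∷ 1866 ∷ 976 ∷ 1324 ∷ 2023 ∷ 2817 ∷ 722 ∷ 608 ∷ 2858 ∷ 2121 ∷ 2576 ∷ 923 ∷ 114 ∷ 868 ∷ 2253 ∷ 640 ∷ 3264 ∷ 2740 ∷ 3107 ∷ 1922 ∷ 504 ∷ 51 ∷ 170 ∷ 3235 ∷ 897 ∷ 1010 ∷ 1489 ∷ 402 ∷ 3326 ∷ 1629 ∷ 2167 ∷ 3635 ∷ 2294 ∷ 1141 ∷ 916 ∷ 106 ∷ 2559 ∷ 2236 ∷ 541 ∷ 1262 ∷ 198 ∷ 2565 ∷ 1583 ∷ 1746 ∷ 555 ∷ 3241 ∷ 2614 ∷ 346 ∷ 3117 ∷ 2472 ∷ 2204 ∷ 601 ∷ 3534 ∷ 19 ∷ 2108 ∷ 1676 ∷ 1479 ∷ 1096 ∷ []) ∷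
    (368 ∷ 1952 ∷ 3636 ∷ 1642 ∷ 3409 ∷ 312 ∷ 3278 ∷ 264 ∷ 1845 ∷ 2158 ∷ 1956 ∷ 1025 ∷ 3530 ∷ 1232 ∷ 774 ∷ 2135 ∷ 3191 ∷ 6 ∷ 554 ∷ 2669 ∷ 3592 ∷ 507 ∷ 18 ∷ 1587 ∷ 1886 ∷ 2354 ∷ 2908 ∷ 1264 ∷ 2869 ∷ 2823 ∷ 2292 ∷ 399 ∷ 2263 ∷ 712 ∷ 1656 ∷ 1153 ∷ 3364 ∷ 1593 ∷ 3184 ∷ 1149 ∷ 657 ∷ 3136 ∷ 1353 ∷ 1115 ∷ 894 ∷ 236 ∷ 2663 ∷ 1136 ∷ 517 ∷ 950 ∷ 2990 ∷ 2201 ∷ 2062 ∷ 683 ∷ 2876 ∷ 1195 ∷ 1281 ∷ 2284 ∷ 2765 ∷ 3244 ∷ 704 ∷ 611 ∷ 391 ∷ 220 ∷ 2772 ∷ 1051 ∷ 613 ∷ 2343 ∷ 418 ∷ 2145 ∷ 1322 ∷ 2562 ∷ 1768 ∷ 1604 ∷ 3165 ∷ 2949 ∷ 2538 ∷ 2751 ∷ 2809 ∷ 1500 ∷ 2269 ∷ []) ∷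
    (56 ∷ 2142 ∷ 490 ∷ 1436 ∷ 411 ∷ 2372 ∷ 3048 ∷ 776 ∷ 2079 ∷ 1718 ∷ 430 ∷ 2631 ∷ 1639 ∷ 2770 ∷ 2438 ∷ 2254 ∷ 2840 ∷ 3476 ∷ 3394 ∷ 1003 ∷ 2090 ∷ 610 ∷ 1808 ∷ 1260 ∷ 3251 ∷ 882 ∷ 1198 ∷ 1635 ∷ 3258 ∷ 88 ∷ 1097 ∷ 403 ∷ 1750 ∷ 838 ∷ 2687 ∷ 3024 ∷ 2548 ∷ 3237 ∷ 1040 ∷ 1537 ∷ 2621 ∷ 1143 ∷ 2128 ∷ 3355 ∷ 15 ∷ 3309 ∷ 1190 ∷ 655 ∷ 3435 ∷ 3155 ∷ 1169 ∷ 437 ∷ 3622 ∷ 311 ∷ 3295 ∷ 108 ∷ 1622 ∷ 2442 ∷ 1380 ∷ 1099 ∷ 2749 ∷ 3362 ∷ 355 ∷ 1681 ∷ 2331 ∷ 2778 ∷ 2073 ∷ 255 ∷ 1986 ∷ 1839 ∷ 2829 ∷ 1511 ∷ 904 ∷ 2644 ∷ 1601 ∷ 524 ∷ 23 ∷ 1767 ∷ 3149 ∷ 2755 ∷ 993 ∷ []) ∷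
    (127 ∷ 775 ∷ 2363 ∷ 1187 ∷ 2913 ∷ 1315 ∷ 2831 ∷ 2927 ∷ 1277 ∷ 874 ∷ 2320 ∷ 3111 ∷ 1056 ∷ 514 ∷ 3406 ∷ 2224 ∷ 2114 ∷ 2505 ∷ 2446 ∷ 1515 ∷ 716 ∷ 580 ∷ 845 ∷ 558 ∷ 2700 ∷ 1818 ∷ 2118 ∷ 2825 ∷ 3571 ∷ 1484 ∷ 1426 ∷ 452 ∷ 2971 ∷ 3346 ∷ 1749 ∷ 158 ∷ 1662 ∷ 3031 ∷ 1394 ∷ 866 ∷ 3526 ∷ 669 ∷ 2724 ∷ 1298 ∷ 79 ∷ 180 ∷ 773 ∷ 1755 ∷ 1804 ∷ 2307 ∷ 398 ∷ 936 ∷ 2431 ∷ 2985 ∷ 1213 ∷ 3152 ∷ 2007 ∷ 1766 ∷ 94 ∷ 3353 ∷ 3038 ∷ 1311 ∷ 2048 ∷ 168 ∷ 3327 ∷ 2425 ∷ 2516 ∷ 1357 ∷ 819 ∷ 3440 ∷ 382 ∷ 679 ∷ 3298 ∷ 3070 ∷ 1443 ∷ 1112 ∷ 31 ∷ 2934 ∷ 2454 ∷ 2297 ∷ 1930 ∷ []) ∷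
    (238 ∷ 1409 ∷ 3045 ∷ 1975 ∷ 1087 ∷ 2352 ∷ 3603 ∷ 756 ∷ 2739 ∷ 3414 ∷ 1126 ∷ 3100 ∷ 205 ∷ 1402 ∷ 419 ∷ 2958 ∷ 1462 ∷ 26 ∷ 1810 ∷ 1496 ∷ 2690 ∷ 1354 ∷ 42 ∷ 3114 ∷ 197 ∷ 2071 ∷ 3062 ∷ 510 ∷ 3051 ∷ 2141 ∷ 1027 ∷ 983 ∷ 2509 ∷ 3616 ∷ 572 ∷ 110 ∷ 2115 ∷ 2594 ∷ 2170 ∷ 2069 ∷ 1876 ∷ 3226 ∷ 887 ∷ 3303 ∷ 1748 ∷ 1208 ∷ 2722 ∷ 2573 ∷ 780 ∷ 1167 ∷ 2653 ∷ 1854 ∷ 3593 ∷ 288 ∷ 2162 ∷ 561 ∷ 1383 ∷ 2012 ∷ 142 ∷ 2232 ∷ 2607 ∷ 881 ∷ 2611 ∷ 2780 ∷ 969 ∷ 1094 ∷ 3410 ∷ 244 ∷ 1965 ∷ 2408 ∷ 1041 ∷ 2811 ∷ 487 ∷ 502 ∷ 990 ∷ 2483 ∷ 3344 ∷ 1627 ∷ 481 ∷ 1582 ∷ 3520 ∷ []) ∷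
    (176 ∷ 2999 ∷ 1395 ∷ 152 ∷ 824 ∷ 1185 ∷ 120 ∷ 2813 ∷ 2476 ∷ 2370 ∷ 1759 ∷ 1388 ∷ 1292 ∷ 1987 ∷ 3144 ∷ 1531 ∷ 2978 ∷ 2567 ∷ 758 ∷ 3016 ∷ 3363 ∷ 3095 ∷ 915 ∷ 1374 ∷ 2888 ∷ 1492 ∷ 3631 ∷ 28 ∷ 2259 ∷ 1286 ∷ 3185 ∷ 1901 ∷ 2546 ∷ 2281 ∷ 2032 ∷ 2380 ∷ 907 ∷ 3450 ∷ 2520 ∷ 3058 ∷ 2417 ∷ 1807 ∷ 199 ∷ 977 ∷ 3216 ∷ 1432 ∷ 245 ∷ 3519 ∷ 1161 ∷ 2153 ∷ 886 ∷ 1788 ∷ 579 ∷ 3127 ∷ 52 ∷ 2914 ∷ 575 ∷ 685 ∷ 768 ∷ 468 ∷ 1613 ∷ 966 ∷ 3505 ∷ 3012 ∷ 1867 ∷ 297 ∷ 3456 ∷ 1499 ∷ 2215 ∷ 2757 ∷ 2474 ∷ 509 ∷ 2575 ∷ 892 ∷ 1814 ∷ 215 ∷ 1572 ∷ 2637 ∷ 1446 ∷ 3467 ∷ 781 ∷ []) ∷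
    (370 ∷ 1998 ∷ 3570 ∷ 3170 ∷ 1179 ∷ 922 ∷ 1558 ∷ 2550 ∷ 2759 ∷ 823 ∷ 912 ∷ 337 ∷ 1758 ∷ 1905 ∷ 2250 ∷ 2361 ∷ 1541 ∷ 3281 ∷ 2467 ∷ 401 ∷ 2540 ∷ 757 ∷ 1669 ∷ 3177 ∷ 3354 ∷ 574 ∷ 3541 ∷ 7 ∷ 2606 ∷ 1016 ∷ 230 ∷ 3074 ∷ 3228 ∷ 1062 ∷ 3156 ∷ 2047 ∷ 2009 ∷ 801 ∷ 529 ∷ 3395 ∷ 2689 ∷ 1637 ∷ 2291 ∷ 2061 ∷ 2967 ∷ 2697 ∷ 2748 ∷ 1992 ∷ 274 ∷ 1299 ∷ 3214 ∷ 1686 ∷ 2563 ∷ 3068 ∷ 27 ∷ 2668 ∷ 1018 ∷ 2674 ∷ 443 ∷ 1520 ∷ 174 ∷ 1600 ∷ 1430 ∷ 1109 ∷ 3596 ∷ 1088 ∷ 3274 ∷ 1456 ∷ 959 ∷ 322 ∷ 1554 ∷ 2943 ∷ 3589 ∷ 2173 ∷ 2357 ∷ 695 ∷ 1355 ∷ 409 ∷ 1727 ∷ 3313 ∷ 1117 ∷ []) ∷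
    (228 ∷ 585 ∷ 2189 ∷ 100 ∷ 1666 ∷ 2003 ∷ 132 ∷ 3615 ∷ 3254 ∷ 3188 ∷ 2553 ∷ 2206 ∷ 2078 ∷ 2821 ∷ 682 ∷ 2285 ∷ 564 ∷ 3345 ∷ 1560 ∷ 578 ∷ 949 ∷ 721 ∷ 1757 ∷ 2168 ∷ 482 ∷ 2334 ∷ 1177 ∷ 32 ∷ 3005 ∷ 2104 ∷ 803 ∷ 2695 ∷ 3396 ∷ 3115 ∷ 2898 ∷ 3198 ∷ 1765 ∷ 1004 ∷ 3322 ∷ 636 ∷ 3211 ∷ 2657 ∷ 195 ∷ 1827 ∷ 762 ∷ 2202 ∷ 279 ∷ 1057 ∷ 1947 ∷ 2939 ∷ 1664 ∷ 2646 ∷ 1405 ∷ 689 ∷ 16 ∷ 476 ∷ 1449 ∷ 1471 ∷ 1570 ∷ 1222 ∷ 2375 ∷ 1736 ∷ 1091 ∷ 622 ∷ 2709 ∷ 251 ∷ 978 ∷ 2317 ∷ 3009 ∷ 3591 ∷ 3316 ∷ 1343 ∷ 3337 ∷ 1710 ∷ 2640 ∷ 187 ∷ 2406 ∷ 3407 ∷ 2248 ∷ 997 ∷ 1607 ∷ []) ∷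
    (309 ∷ 1908 ∷ 3488 ∷ 2487 ∷ 2270 ∷ 276 ∷ 843 ∷ 268 ∷ 666 ∷ 2738 ∷ 3418 ∷ 456 ∷ 213 ∷ 3292 ∷ 2721 ∷ 1791 ∷ 3335 ∷ 717 ∷ 1078 ∷ 2084 ∷ 1846 ∷ 3403 ∷ 2329 ∷ 1747 ∷ 181 ∷ 1085 ∷ 1688 ∷ 3397 ∷ 2249 ∷ 113 ∷ 2185 ∷ 432 ∷ 1838 ∷ 802 ∷ 3086 ∷ 1424 ∷ 1641 ∷ 2979 ∷ 3090 ∷ 2398 ∷ 1030 ∷ 3196 ∷ 3279 ∷ 1059 ∷ 659 ∷ 3477 ∷ 703 ∷ 2415 ∷ 563 ∷ 2776 ∷ 332 ∷ 2790 ∷ 1258 ∷ 884 ∷ 1745 ∷ 97 ∷ 645 ∷ 2366 ∷ 3020 ∷ 1530 ∷ 557 ∷ 3426 ∷ 2028 ∷ 1817 ∷ 763 ∷ 2283 ∷ 1138 ∷ 2456 ∷ 2902 ∷ 2159 ∷ 360 ∷ 1172 ∷ 3269 ∷ 1486 ∷ 1303 ∷ 1651 ∷ 2287 ∷ 2727 ∷ 770 ∷ 1552 ∷ 2634 ∷ []) ∷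
    (76 ∷ 1300 ∷ 2952 ∷ 618 ∷ 2889 ∷ 1586 ∷ 2246 ∷ 3182 ∷ 1221 ∷ 964 ∷ 2900 ∷ 1813 ∷ 821 ∷ 2008 ∷ 1692 ∷ 1420 ∷ 2070 ∷ 2618 ∷ 2528 ∷ 3441 ∷ 1240 ∷ 3064 ∷ 1046 ∷ 410 ∷ 2449 ∷ 3248 ∷ 3580 ∷ 865 ∷ 2432 ∷ 126 ∷ 3559 ∷ 375 ∷ 932 ∷ 3252 ∷ 1909 ∷ 2190 ∷ 1714 ∷ 2411 ∷ 3454 ∷ 719 ∷ 1803 ∷ 3565 ∷ 1334 ∷ 2577 ∷ 43 ∷ 2491 ∷ 3588 ∷ 3141 ∷ 2649 ∷ 2321 ∷ 3639 ∷ 2883 ∷ 2796 ∷ 275 ∷ 2445 ∷ 82 ∷ 828 ∷ 1648 ∷ 594 ∷ 3497 ∷ 1907 ∷ 2560 ∷ 343 ∷ 879 ∷ 1465 ∷ 2000 ∷ 1247 ∷ 259 ∷ 1192 ∷ 1005 ∷ 1979 ∷ 725 ∷ 3358 ∷ 1850 ∷ 807 ∷ 2938 ∷ 35 ∷ 925 ∷ 2347 ∷ 1953 ∷ 3431 ∷ []) ∷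
    (125 ∷ 1038 ∷ 2626 ∷ 148 ∷ 1413 ∷ 3035 ∷ 156 ∷ 1399 ∷ 3001 ∷ 2026 ∷ 1819 ∷ 1643 ∷ 707 ∷ 3504 ∷ 2508 ∷ 3551 ∷ 2922 ∷ 2420 ∷ 414 ∷ 3287 ∷ 3415 ∷ 1915 ∷ 808 ∷ 1350 ∷ 2319 ∷ 872 ∷ 1892 ∷ 440 ∷ 2111 ∷ 2566 ∷ 171 ∷ 2706 ∷ 2747 ∷ 1525 ∷ 893 ∷ 2426 ∷ 989 ∷ 3610 ∷ 2893 ∷ 372 ∷ 2941 ∷ 1713 ∷ 651 ∷ 2948 ∷ 1902 ∷ 2633 ∷ 2580 ∷ 1709 ∷ 910 ∷ 21 ∷ 461 ∷ 3166 ∷ 2041 ∷ 2020 ∷ 2100 ∷ 906 ∷ 531 ∷ 3121 ∷ 782 ∷ 2529 ∷ 167 ∷ 1079 ∷ 1110 ∷ 1021 ∷ 3393 ∷ 952 ∷ 1602 ∷ 3608 ∷ 469 ∷ 2522 ∷ 2049 ∷ 69 ∷ 2665 ∷ 1257 ∷ 1958 ∷ 2295 ∷ 3514 ∷ 1344 ∷ 388 ∷ 3349 ∷ 1361 ∷ []) ∷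
    (105 ∷ 1816 ∷ 3468 ∷ 136 ∷ 2191 ∷ 589 ∷ 128 ∷ 2225 ∷ 603 ∷ 2844 ∷ 2605 ∷ 2477 ∷ 1509 ∷ 1082 ∷ 3302 ∷ 1105 ∷ 540 ∷ 3238 ∷ 1216 ∷ 833 ∷ 1009 ∷ 2741 ∷ 1610 ∷ 2112 ∷ 3137 ∷ 1698 ∷ 2694 ∷ 1290 ∷ 2961 ∷ 3336 ∷ 165 ∷ 3540 ∷ 3509 ∷ 2311 ∷ 1719 ∷ 3212 ∷ 1855 ∷ 1148 ∷ 447 ∷ 376 ∷ 551 ∷ 2539 ∷ 1485 ∷ 534 ∷ 2704 ∷ 3451 ∷ 3382 ∷ 2583 ∷ 1712 ∷ 49 ∷ 1239 ∷ 792 ∷ 2899 ∷ 2798 ∷ 2870 ∷ 1756 ∷ 1301 ∷ 715 ∷ 1616 ∷ 3323 ∷ 225 ∷ 1937 ∷ 1896 ∷ 1823 ∷ 899 ∷ 1770 ∷ 2356 ∷ 1210 ∷ 1231 ∷ 3340 ∷ 2891 ∷ 73 ∷ 3419 ∷ 2083 ∷ 2800 ∷ 3081 ∷ 1092 ∷ 2138 ∷ 352 ∷ 903 ∷ 2131 ∷ []) ∷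
    (348 ∷ 2826 ∷ 1142 ∷ 2468 ∷ 1035 ∷ 316 ∷ 832 ∷ 292 ∷ 2599 ∷ 2984 ∷ 2782 ∷ 1859 ∷ 1076 ∷ 2098 ∷ 1544 ∷ 2937 ∷ 777 ∷ 72 ∷ 1348 ∷ 3455 ∷ 1146 ∷ 1325 ∷ 4 ∷ 2381 ∷ 2720 ∷ 3204 ∷ 422 ∷ 2066 ∷ 471 ∷ 3625 ∷ 3134 ∷ 371 ∷ 3041 ∷ 1474 ∷ 2434 ∷ 1955 ∷ 958 ∷ 2355 ∷ 794 ∷ 1999 ∷ 1459 ∷ 690 ∷ 2139 ∷ 1941 ∷ 1728 ∷ 200 ∷ 3481 ∷ 1962 ∷ 1335 ∷ 1752 ∷ 512 ∷ 3043 ∷ 2848 ∷ 1533 ∷ 454 ∷ 2013 ∷ 2059 ∷ 3142 ∷ 3583 ∷ 846 ∷ 1482 ∷ 1453 ∷ 379 ∷ 224 ∷ 3566 ∷ 1853 ∷ 1391 ∷ 3113 ∷ 1252 ∷ 2947 ∷ 2180 ∷ 3380 ∷ 2554 ∷ 2374 ∷ 783 ∷ 543 ∷ 3324 ∷ 3545 ∷ 3579 ∷ 2326 ∷ 3087 ∷ []) ∷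
    (46 ∷ 1196 ∷ 2832 ∷ 2619 ∷ 477 ∷ 1434 ∷ 975 ∷ 3030 ∷ 2033 ∷ 3217 ∷ 1849 ∷ 345 ∷ 3359 ∷ 738 ∷ 3246 ∷ 1685 ∷ 1926 ∷ 1230 ∷ 1581 ∷ 393 ∷ 3445 ∷ 3265 ∷ 2890 ∷ 3490 ∷ 1723 ∷ 1674 ∷ 2350 ∷ 1403 ∷ 1668 ∷ 1345 ∷ 2904 ∷ 2226 ∷ 99 ∷ 588 ∷ 2950 ∷ 2643 ∷ 635 ∷ 1737 ∷ 499 ∷ 2424 ∷ 433 ∷ 793 ∷ 1234 ∷ 694 ∷ 2750 ∷ 2344 ∷ 301 ∷ 2435 ∷ 1967 ∷ 13 ∷ 1132 ∷ 2853 ∷ 2989 ∷ 2373 ∷ 3071 ∷ 2957 ∷ 3272 ∷ 2216 ∷ 1031 ∷ 1362 ∷ 1276 ∷ 87 ∷ 598 ∷ 692 ∷ 855 ∷ 317 ∷ 1217 ∷ 785 ∷ 1313 ∷ 3611 ∷ 2744 ∷ 77 ∷ 2239 ∷ 2143 ∷ 3325 ∷ 2846 ∷ 1106 ∷ 2282 ∷ 764 ∷ 2365 ∷ 2037 ∷ []) ∷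
    (390 ∷ 1140 ∷ 2808 ∷ 2368 ∷ 3569 ∷ 3360 ∷ 740 ∷ 1732 ∷ 1989 ∷ 3277 ∷ 3350 ∷ 349 ∷ 924 ∷ 1111 ∷ 1384 ∷ 1567 ∷ 747 ∷ 2479 ∷ 1633 ∷ 357 ∷ 1722 ∷ 3171 ∷ 851 ∷ 2351 ∷ 2568 ∷ 3060 ∷ 2715 ∷ 45 ∷ 1828 ∷ 3478 ∷ 194 ∷ 2240 ∷ 2410 ∷ 3484 ∷ 2330 ∷ 1253 ∷ 1159 ∷ 3167 ∷ 2983 ∷ 2537 ∷ 1927 ∷ 883 ∷ 1505 ∷ 1219 ∷ 2165 ∷ 1919 ∷ 1898 ∷ 1166 ∷ 262 ∷ 513 ∷ 2364 ∷ 844 ∷ 1769 ∷ 2266 ∷ 1 ∷ 1826 ∷ 3416 ∷ 1872 ∷ 2857 ∷ 726 ∷ 178 ∷ 798 ∷ 644 ∷ 3507 ∷ 2802 ∷ 3558 ∷ 2496 ∷ 638 ∷ 3373 ∷ 294 ∷ 784 ∷ 2109 ∷ 2819 ∷ 1339 ∷ 1611 ∷ 3101 ∷ 537 ∷ 2871 ∷ 965 ∷ 2447 ∷ 3499 ∷ []) ∷ []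

differenceIndex : G → Fin 45 × Fin 9 × Fin 9
differenceIndex (u , e) = (c / 81) mod 45 , (c / 9) mod 9 , c mod 9
  where c = lookup (lookup differenceTable e) (Inverse.from Fin81↔K u)

difference-differenceIndex : ∀ d → proj₂ d ≢ ℤ₄₁.0# →
                             let r , i , j = differenceIndex d in difference base r i j ≡ d
difference-differenceIndex = by-exhaustion (×-exhaustible K-exhaustible all?)
  (λ d → ¬? (proj₂ d Fin.≟ ℤ₄₁.0#) →-dec
         (let r , i , j = differenceIndex d in difference base r i j ≟ᴳ d))
  where
  _≟ᴳ_ : DecidableEquality G
  _≟ᴳ_ = ×-≡-dec _≟ᴷ_ Fin._≟_

differenceIndex-difference : ∀ t → let r , i , j = t in i ≢ j →
                             proj₂ (difference base r i j) ≢ ℤ₄₁.0# ×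
                             differenceIndex (difference base r i j) ≡ t
differenceIndex-difference = by-exhaustion (×-exhaustible all? (×-exhaustible all? all?))
  (λ (r , i , j) → ¬? (i Fin.≟ j) →-dec
                   (¬? (proj₂ (difference base r i j) Fin.≟ ℤ₄₁.0#) ×-dec
                    differenceIndex (difference base r i j) ≟ᵀ (r , i , j)))
  where
  _≟ᵀ_ : DecidableEquality (Fin 45 × Fin 9 × Fin 9)
  _≟ᵀ_ = ×-≡-dec Fin._≟_ (×-≡-dec Fin._≟_ Fin._≟_)

base-isRelativeDifferenceFamily : IsRelativeDifferenceFamily base
base-isRelativeDifferenceFamily = record
  { difference∉K      = λ r {i} {j} i≢j → proj₁ (differenceIndex-difference (r , i , j) i≢j)
  ; difference-covers = λ d d∉K →
      let r , i , j = differenceIndex d in r , i , j , difference-differenceIndex d d∉K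
  ; difference-unique = λ i≢j i′≢j′ eq →
      let same-index = trans (sym (proj₂ (differenceIndex-difference _ i≢j)))
                             (trans (cong differenceIndex eq) (proj₂ (differenceIndex-difference _ i′≢j′)))
      in cong proj₁ same-index , cong (proj₁ ∘ proj₂) same-index
  }

G↔Fin : G ↔ Fin 3321
G↔Fin = ↔-sym (↔-trans *↔× (Fin81↔K ×-↔ ↔-refl))

Block↔Fin : ((Fin 45 × G) ⊎ (Line × Fin 41)) ↔ Fin (45 ℕ.* 3321 ℕ.+ 90 ℕ.* 41)
Block↔Fin = ↔-sym (↔-trans (+↔⊎ {45 ℕ.* 3321}) (translates ⊎-↔ lines))
  where
  translates : Fin (45 ℕ.* 3321) ↔ (Fin 45 × G)
  translates = ↔-trans (*↔× {45}) (↔-refl ×-↔ ↔-sym G↔Fin)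
  lines : Fin (90 ℕ.* 41) ↔ (Line × Fin 41)
  lines = ↔-trans (*↔× {90}) (↔-trans +↔⊎ (Fin9↔F₉ ⊎-↔ Fin81↔K) ×-↔ ↔-refl)

mainTheorem2 : SteinerSystem₂ 9 3321
mainTheorem2 =
  toSteinerSystem₂ (relabel (develop base-isRelativeDifferenceFamily affinePlane) G↔Fin) Block↔Fin
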